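{- Let $n\in\mathbb{N}$ and for $i=1,\dots,5$ let $d_i=5n(i-1)+1$ and $R_i=\{5,d_i,25n-d_i,25n+d_i,50n-d_i,50n+d_i\}$. Then the graphs $C_{125n}(R_i)$, $1\le i\le5$, are Type-2 isomorphic circulant graphs w.r.t. $m=5$, $T2_{125n,5}(C_{125n}(R_i))=\{C_{125n}(R_j):j=1,2,3,4,5\}$ for each $i$, and $(T2_{125n,5}(C_{125n}(R_i)),\circ)$ is a group (the Type-2 group).
   Context: Circulant graph $C_N(R)$: vertices $v_0,\dots,v_{N-1}$, $v_x$ adjacent to $v_{x\pm s}$, $s\in R$; jump sets written in $[1,N/2]$ after reflexive reduction modulo $N$ (reduce mod $N$, replace values $>N/2$ by $N$ minus the value). For $m\mid N$, $0\le t\le\tfrac Nm-1$, $\theta_{N,m,t}$ maps $v_x$, $x=qm+j$, $0\le j\le m-1$, to $u_{x+jmt}$ (subscripts mod $N$) and edges to pairs of images; $\theta_{N,m,t}(C_N(R))$ is the image graph, written $C_N(\theta_{N,m,t}(R))$. Type-2 isomorphism w.r.t. $m$: $C_N(R)$, $C_N(S)$ with $|R|=|S|\ge3$, $R\ne S$, are Type-2 isomorphic w.r.t. $m$ if some $r\in R$ has $m>1$, $m\mid\gcd(N,r)$, $m^3\mid N$, $\theta_{N,m,t}(C_N(R))=C_N(S)$ for some $1\le t\le\tfrac Nm-1$, and $S\ne xR$ (reflexive mod $N$) for all $x$ coprime to $N$. $T2_{N,m}(C_N(R))=\{C_N(R)\}\cup\{C_N(S):C_N(S)$ Type-2 isomorphic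 to $C_N(R)$ w.r.t. $m\}$, with operation $\theta_{N,m,t}(C_N(R))\circ\theta_{N,m,t'}(C_N(R))=\theta_{N,m,t+t'}(C_N(R))$, $t+t'$ modulo $\tfrac Nm$. -}

module Defs where

open import Data.Nat using (ℕ; zero; suc; _+_; _*_; _∸_; _≤_; _<_; _≤ᵇ_)
open import Data.Nat.Properties using (_≟_)
open import Data.Nat.DivMod using (_%_; _/_)
open import Data.Nat.Divisibility using (_∣_)
open import Data.Nat.GCD using (gcd)
open import Data.Nat.Coprimality using (Coprime)
open import Data.Bool using (if_then_else_)
open import Data.List using (List; []; _∷_; map; length; deduplicate)
open import Data.List.Membership.Propositional using (_∈_)
open import Data.Product using (Σ; ∃; ∃-syntax; _×_; proj₁)
open import Data.Sum using (_⊎_)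
open import Function.Bundles using (_⇔_)
open import Relation.Nullary using (¬_)
open import Relation.Binary.PropositionalEquality using (_≡_)
open import Algebra.Structures using (IsGroup)

-- Total versions of mod / div (only ever used with a nonzero modulus here).
_mod_ : ℕ → ℕ → ℕ
a mod zero = a
a mod suc k = a % suc k

_div_ : ℕ → ℕ → ℕ
a div zero = 0
a div suc k = a / suc k

-- Jump sets are finite lists of naturals (unreduced).
JumpSet : Set
JumpSet = List ℕ

red : ℕ → ℕ → ℕ
red N r = if (r mod N) ≤ᵇ (N div 2) then r mod N else N ∸ (r mod N)

SetEq : ℕ → JumpSet → JumpSet → Set
SetEq N R S = ∀ s → (s ∈ map (red N) R) ⇔ (s ∈ map (red N) S)

card : ℕ → JumpSet → ℕ
card N R = length (deduplicate _≟_ (map (red N) R))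

-- xR (reflexive mod N, reduction applied by SetEq)
scale : ℕ → JumpSet → JumpSet
scale x R = map (x *_) R

Adj : ℕ → JumpSet → ℕ → ℕ → Set
Adj N R x y = ∃[ s ] (s ∈ R × ((x + s) mod N ≡ y ⊎ (y + s) mod N ≡ x))

θ : ℕ → ℕ → ℕ → ℕ → ℕ
θ N m t x = (x + (x mod m) * m * t) mod N

ImgAdj : ℕ → ℕ → ℕ → JumpSet → ℕ → ℕ → Set
ImgAdj N m t R a b =
  ∃[ x ] ∃[ y ] (x < N × y < N × Adj N R x y × θ N m t x ≡ a × θ N m t y ≡ b)

ImgEq : ℕ → ℕ → ℕ → JumpSet → JumpSet → Set
ImgEq N m t R S = ∀ a b → a < N → b < N → ImgAdj N m t R a b ⇔ Adj N S a b

Type2Iso : ℕ → ℕ → JumpSet → JumpSet → Set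
Type2Iso N m R S =
  card N R ≡ card N S × 3 ≤ card N R × ¬ SetEq N R S
  × 1 < m × (∃[ r ] (r ∈ R × m ∣ gcd N r)) × (m * m * m) ∣ N
  × (∃[ t ] (1 ≤ t × t ≤ N div m ∸ 1 × ImgEq N m t R S))
  × (∀ x → Coprime x N → ¬ SetEq N S (scale x R))

InT2 : ℕ → ℕ → JumpSet → JumpSet → Set
InT2 N m R S = SetEq N S R ⊎ Type2Iso N m R S

T2Carrier : ℕ → ℕ → JumpSet → Set
T2Carrier N m R = Σ JumpSet (InT2 N m R)

GraphEq : (N m : ℕ) (R : JumpSet) → T2Carrier N m R → T2Carrier N m R → Set
GraphEq N m R a b = SetEq N (proj₁ a) (proj₁ b)

Rep : (N m : ℕ) (R : JumpSet) → T2Carrier N m R → ℕ → Set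
Rep N m R a t = t < N div m × ImgEq N m t R (proj₁ a)

Type2Group : ℕ → ℕ → JumpSet → Set
Type2Group N m R =
  Σ (T2Carrier N m R → T2Carrier N m R → T2Carrier N m R) λ _∘_ →
  Σ (T2Carrier N m R) λ e →
  Σ (T2Carrier N m R → T2Carrier N m R) λ inv →
    IsGroup (GraphEq N m R) _∘_ e inv
    × (∀ a b t t' → Rep N m R a t → Rep N m R b t'
         → Rep N m R (a ∘ b) ((t + t') mod (N div m)))

d : ℕ → ℕ → ℕ
d n i = 5 * n * (i ∸ 1) + 1

Rset : ℕ → ℕ → JumpSet
Rset n i = 5 ∷ d n i ∷ (25 * n ∸ d n i) ∷ (25 * n + d n i)
             ∷ (50 * n ∸ d n i) ∷ (50 * n + d n i) ∷ []

module Submission where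

-- Write M = 25n, N = 125n = 5M and δᵢ = 5n(i-1)+1, so δᵢ ≡ 1 (mod 5).  Up to sign
-- modulo N the jumps of Rᵢ are 5 and the five lifts δᵢ + rM (r < 5) of δᵢ, so z is a
-- jump of C_N(Rᵢ) iff z ≡ ±5 (mod N) or z ≡ ±δᵢ (mod M).  θ_{N,5,t} changes a
-- difference y - x by 5t((y mod 5) - (x mod 5)); for t = nk this keeps the class of ±5
-- and moves δ to δ + 5nk (mod M), so it maps C_N(Rᵢ) onto C_N(R_{i+k}), indices mod 5.
-- Conversely, pulling back a translate of the image of the edge 0 — δᵢ shows that t
-- must be a multiple of n.  Reducing modulo 5 and modulo M shows that the Rᵢ are
-- pairwise distinct, have six distinct jumps and are not unit multiples of each other.
-- Hence T2 = {R₁, …, R₅}, and the index offset identifies (T2, ∘) with ℤ/5ℤ.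

open import Defs

open import Algebra.Bundles.Raw using (RawGroup)
import Algebra.Morphism.GroupMonomorphism as GroupMonomorphism
open import Algebra.Morphism.Structures using (IsGroupMonomorphism)
open import Algebra.Structures using (IsGroup)
open import Data.Bool.Base using (true; false; T)
open import Data.Empty using (⊥-elim)
open import Data.Integer.DivMod using (_%ℕ_; _/ℕ_; a≡a%ℕn+[a/ℕn]*n; n%ℕd<d)
open import Data.Integer.Divisibility.Signed
  using (_∣_; _∣?_; divides; ∣-trans; ∣m∣n⇒∣m+n; ∣m⇒∣-m; ∣n⇒∣m*n; *-monoˡ-∣; *-cancelʳ-∣;
         ∣⇒∣ᵤ; ∣ᵤ⇒∣)
import Data.Integer.Properties as ℤ
open import Data.Integer.Tactic.RingSolver using (solve)
open import Data.List.Base using (List; []; _∷_; map; length)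
open import Data.List.Membership.Propositional using (_∈_)
open import Data.List.Membership.Propositional.Properties using (∈-map⁺; ∈-map⁻; deduplicate-∈⇔)
open import Data.List.Membership.Propositional.Properties.WithK using (unique∧set⇒bag)
open import Data.List.Properties using (length-map)
open import Data.List.Relation.Binary.BagAndSetEquality using (∼bag⇒↭)
open import Data.List.Relation.Binary.Permutation.Propositional.Properties using (↭-length)
import Data.List.Relation.Unary.All as All
open import Data.List.Relation.Unary.AllPairs using (AllPairs)
import Data.List.Relation.Unary.AllPairs as AllPairs
import Data.List.Relation.Unary.AllPairs.Properties as AllPairs
open import Data.List.Relation.Unary.Any using (here; there)
open import Data.List.Relation.Unary.Unique.Propositional using (Unique)
open import Data.Nat.Base as ℕ using (ℕ; zero; suc; _<_; _∸_; z≤n; s≤s)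
open import Data.Nat.DivMod as ℕ using (_%_; _/_)
import Data.Nat.Divisibility as ℕ
open import Data.Nat.GCD using (gcd-greatest)
import Data.Nat.Properties as ℕ
import Data.Nat.Tactic.RingSolver as ℕ-Solver
open import Data.List.Relation.Unary.Unique.DecPropositional.Properties ℕ._≟_ using (deduplicate-!)
open import Data.Product.Base using (∃-syntax; _×_; _,_; proj₁; proj₂)
open import Data.Sum.Base using (_⊎_; inj₁; inj₂)
open import Function.Base using (_∘_)
open import Function.Bundles using (_⇔_; mk⇔; Equivalence)
import Function.Properties.Equivalence as ⇔
open import Relation.Binary.Bundles using (Setoid)
open import Relation.Binary.PropositionalEquality using (_≡_; _≢_; refl; sym; trans; cong; cong₂; subst; subst₂)
open import Relation.Binary.PropositionalEquality.Properties using (module ≡-Reasoning)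
import Relation.Binary.Reasoning.Setoid as SetoidReasoning
open import Relation.Nullary using (¬_; Dec; yes; no)
open import Relation.Nullary.Decidable using (False; from-no; toWitnessFalse; map′)

module Congruence where

  open import Data.Integer.Base using (ℤ; +_; -_; _+_; _-_; _*_; ∣_∣; NonZero)

  infix 4 _≡_[mod_] _≡±_[mod_]

  -- A record rather than m ∣ a - b itself, so that a, b and m are recovered by unification.
  record _≡_[mod_] (a b m : ℤ) : Set where
    constructor mod-divides
    field m∣a-b : m ∣ a - b

  private
    ∣-respʳ : ∀ {m x y} → m ∣ x → x ≡ y → m ∣ y
    ∣-respʳ m∣x refl = m∣x

  ≡+multiple⇒≡-mod : ∀ {m a b} q → a ≡ b + q * m → a ≡ b [mod m ]
  ≡+multiple⇒≡-mod {m} {b = b} q refl = mod-divides (divides q (solve (b ∷ q ∷ m ∷ [])))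

  module _ {m : ℤ} where

    mod-reflexive : ∀ {a b} → a ≡ b → a ≡ b [mod m ]
    mod-reflexive {a} refl = ≡+multiple⇒≡-mod (+ 0) (solve (a ∷ m ∷ []))

    mod-refl : ∀ {a} → a ≡ a [mod m ]
    mod-refl = mod-reflexive refl

    mod-sym : ∀ {a b} → a ≡ b [mod m ] → b ≡ a [mod m ]
    mod-sym {a} {b} (mod-divides p) = mod-divides (∣-respʳ (∣m⇒∣-m p) (solve (a ∷ b ∷ [])))

    mod-trans : ∀ {a b c} → a ≡ b [mod m ] → b ≡ c [mod m ] → a ≡ c [mod m ]
    mod-trans {a} {b} {c} (mod-divides p) (mod-divides q) =
      mod-divides (∣-respʳ (∣m∣n⇒∣m+n p q) (solve (a ∷ b ∷ c ∷ [])))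

    mod-setoid : Setoid _ _
    mod-setoid = record
      { Carrier = ℤ
      ; _≈_ = _≡_[mod m ]
      ; isEquivalence = record { refl = mod-refl ; sym = mod-sym ; trans = mod-trans }
      }

    +-cong-mod : ∀ {a b c d} → a ≡ b [mod m ] → c ≡ d [mod m ] → a + c ≡ b + d [mod m ]
    +-cong-mod {a} {b} {c} {d} (mod-divides p) (mod-divides q) =
      mod-divides (∣-respʳ (∣m∣n⇒∣m+n p q) (solve (a ∷ b ∷ c ∷ d ∷ [])))

    neg-cong-mod : ∀ {a b} → a ≡ b [mod m ] → - a ≡ - b [mod m ]
    neg-cong-mod {a} {b} (mod-divides p) = mod-divides (∣-respʳ (∣m⇒∣-m p) (solve (a ∷ b ∷ [])))

    *-congˡ-mod : ∀ c {a b} → a ≡ b [mod m ] → c * a ≡ c * b [mod m ]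
    *-congˡ-mod c {a} {b} (mod-divides p) =
      mod-divides (∣-respʳ (∣n⇒∣m*n c p) (solve (a ∷ b ∷ c ∷ [])))

    *-scale-mod : ∀ c {a b} → a ≡ b [mod m ] → a * c ≡ b * c [mod m * c ]
    *-scale-mod c {a} {b} (mod-divides p) =
      mod-divides (∣-respʳ {x = (a - b) * c} (*-monoˡ-∣ c p) (solve (a ∷ b ∷ c ∷ [])))

    *-cancel-mod : ∀ c {a b} .{{_ : NonZero c}} → a * c ≡ b * c [mod m * c ] → a ≡ b [mod m ]
    *-cancel-mod c {a} {b} (mod-divides p) =
      mod-divides (*-cancelʳ-∣ c (∣-respʳ {y = (a - b) * c} p (solve (a ∷ b ∷ c ∷ []))))

    modulus≡0-mod : m ≡ + 0 [mod m ]
    modulus≡0-mod = ≡+multiple⇒≡-mod (+ 1) (solve (m ∷ []))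

    multiple≡0-mod : ∀ q → q * m ≡ + 0 [mod m ]
    multiple≡0-mod q = ≡+multiple⇒≡-mod q (solve (q ∷ m ∷ []))

    multipleˡ≡0-mod : ∀ q → m * q ≡ + 0 [mod m ]
    multipleˡ≡0-mod q = ≡+multiple⇒≡-mod q (solve (q ∷ m ∷ []))

    *-multiple≡0-mod : ∀ a b → a * (m * b) ≡ + 0 [mod m ]
    *-multiple≡0-mod a b = ≡+multiple⇒≡-mod (a * b) (solve (a ∷ b ∷ m ∷ []))

    +-absorbʳ-mod : ∀ {a b} → b ≡ + 0 [mod m ] → a + b ≡ a [mod m ]
    +-absorbʳ-mod {a} b≡0 = mod-trans (+-cong-mod (mod-refl {a = a}) b≡0) (mod-reflexive (ℤ.+-identityʳ a))

    -‿absorbʳ-mod : ∀ {a b} → b ≡ + 0 [mod m ] → a - b ≡ a [mod m ]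
    -‿absorbʳ-mod b≡0 = +-absorbʳ-mod (neg-cong-mod b≡0)

    +-absorbˡ-mod : ∀ {a b} → a ≡ + 0 [mod m ] → a + b ≡ b [mod m ]
    +-absorbˡ-mod {b = b} a≡0 =
      mod-trans (+-cong-mod a≡0 (mod-refl {a = b})) (mod-reflexive (ℤ.+-identityˡ b))

    mod-dec : ∀ a b → Dec (a ≡ b [mod m ])
    mod-dec a b = map′ mod-divides _≡_[mod_].m∣a-b (m ∣? a - b)

  module ModReasoning (m : ℤ) = SetoidReasoning (mod-setoid {m})

  +-0-isGroup-mod : ∀ m → IsGroup (_≡_[mod m ]) _+_ (+ 0) (-_)
  +-0-isGroup-mod m = record
    { isMonoid = record
      { isSemigroup = record
        { isMagma = record { isEquivalence = Setoid.isEquivalence (mod-setoid {m}) ; ∙-cong = +-cong-mod }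
        ; assoc = λ a b c → mod-reflexive (ℤ.+-assoc a b c)
        }
      ; identity = (λ a → mod-reflexive (ℤ.+-identityˡ a)) , (λ a → mod-reflexive (ℤ.+-identityʳ a))
      }
    ; inverse = (λ a → mod-reflexive (ℤ.+-inverseˡ a)) , (λ a → mod-reflexive (ℤ.+-inverseʳ a))
    ; ⁻¹-cong = neg-cong-mod
    }

  mod-weaken : ∀ {k m a b} → k ∣ m → a ≡ b [mod m ] → a ≡ b [mod k ]
  mod-weaken k∣m (mod-divides m∣a-b) = mod-divides (∣-trans k∣m m∣a-b)

  mod-resp-modulus : ∀ {m m' a b} → m ≡ m' → a ≡ b [mod m ] → a ≡ b [mod m' ]
  mod-resp-modulus refl a≡b = a≡b

  +-cancelˡ-mod : ∀ {m} c {a b} → c + a ≡ c + b [mod m ] → a ≡ b [mod m ]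
  +-cancelˡ-mod c {a} {b} c+a≡c+b = mod-trans {b = - c + (c + a)} (mod-reflexive (solve (a ∷ c ∷ [])))
    (mod-trans (+-cong-mod (mod-refl {a = - c}) c+a≡c+b) (mod-reflexive (solve (b ∷ c ∷ []))))

  +-cancelʳ-mod : ∀ {m} c {a b} → a + c ≡ b + c [mod m ] → a ≡ b [mod m ]
  +-cancelʳ-mod c {a} {b} a+c≡b+c =
    +-cancelˡ-mod c (mod-trans (mod-reflexive (ℤ.+-comm c a))
                               (mod-trans a+c≡b+c (mod-reflexive (ℤ.+-comm b c))))

  mod-shift : ∀ {m a b c} → a ≡ b + c [mod m ] → a - b ≡ c [mod m ]
  mod-shift {b = b} {c} a≡b+c = mod-trans (+-cong-mod a≡b+c mod-refl) (mod-reflexive (solve (b ∷ c ∷ [])))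

  mod-unshift : ∀ {m a b c} → a - b ≡ c [mod m ] → a ≡ b + c [mod m ]
  mod-unshift {a = a} {b} a-b≡c =
    mod-trans {b = b + (a - b)} (mod-reflexive (solve (a ∷ b ∷ []))) (+-cong-mod (mod-refl {a = b}) a-b≡c)

  mod-diff≡0 : ∀ {m a b} → a - b ≡ + 0 [mod m ] → a ≡ b [mod m ]
  mod-diff≡0 {b = b} a-b≡0 = mod-trans (mod-unshift {b = b} a-b≡0) (mod-reflexive (ℤ.+-identityʳ b))

  mod-swap : ∀ {m a b c} → a - b ≡ c [mod m ] → b - a ≡ - c [mod m ]
  mod-swap {a = a} {b} a-b≡c =
    mod-trans {b = - (a - b)} (mod-reflexive (solve (a ∷ b ∷ []))) (neg-cong-mod a-b≡c)

  mod-swap⁻ : ∀ {m a b c} → a - b ≡ - c [mod m ] → b - a ≡ c [mod m ]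
  mod-swap⁻ {a = a} {b} {c} a-b≡-c =
    mod-trans (mod-swap {a = a} {b} a-b≡-c) (mod-reflexive (ℤ.neg-involutive c))

  pos-∸ : ∀ {m n} → n ℕ.≤ m → + (m ∸ n) ≡ + m - + n
  pos-∸ {m} {n} n≤m = sym (trans (ℤ.[+m]-[+n]≡m⊖n m n) (ℤ.⊖-≥ n≤m))

  %-mod : ∀ a m .{{_ : ℕ.NonZero m}} → + (a % m) ≡ + a [mod + m ]
  %-mod a m = mod-sym (≡+multiple⇒≡-mod (+ (a / m)) (begin
    + a                           ≡⟨ cong +_ (ℕ.m≡m%n+[m/n]*n a m) ⟩
    + (a % m ℕ.+ a / m ℕ.* m)     ≡⟨ ℤ.pos-+ (a % m) (a / m ℕ.* m) ⟩
    + (a % m) + + (a / m ℕ.* m)   ≡⟨ cong (_+_ (+ (a % m))) (ℤ.pos-* (a / m) m) ⟩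
    + (a % m) + + (a / m) * + m   ∎))
    where open ≡-Reasoning

  %ℕ-mod : ∀ z m .{{_ : ℕ.NonZero m}} → + (z %ℕ m) ≡ z [mod + m ]
  %ℕ-mod z m = mod-sym (≡+multiple⇒≡-mod (z /ℕ m) (a≡a%ℕn+[a/ℕn]*n z m))

  ≡0-mod⇒∣ : ∀ {m a} → + a ≡ + 0 [mod + m ] → m ℕ.∣ a
  ≡0-mod⇒∣ {m} {a} (mod-divides m∣a-0) = subst (m ℕ.∣_) (ℕ.+-identityʳ a) (∣⇒∣ᵤ m∣a-0)

  private
    mod-unique-≤ : ∀ {m a b} → a ℕ.≤ b → b < m → + b ≡ + a [mod + m ] → b ≡ a
    mod-unique-≤ {m} {a} {b} a≤b b<m (mod-divides m∣b-a) =
      ℕ.≤-antisym (ℕ.m∸n≡0⇒m≤n b∸a≡0) a≤b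
      where
      instance _ = ℕ.>-nonZero (ℕ.≤-<-trans z≤n b<m)
      m∣b∸a : m ℕ.∣ b ∸ a
      m∣b∸a = subst (m ℕ.∣_) (cong ∣_∣ (sym (pos-∸ a≤b))) (∣⇒∣ᵤ m∣b-a)
      b∸a≡0 : b ∸ a ≡ 0
      b∸a≡0 = trans (sym (ℕ.m<n⇒m%n≡m (ℕ.≤-<-trans (ℕ.m∸n≤m b a) b<m)))
                    (ℕ.n∣m⇒m%n≡0 (b ∸ a) m m∣b∸a)

  mod-unique : ∀ {m a b} → a < m → b < m → + a ≡ + b [mod + m ] → a ≡ b
  mod-unique {a = a} {b} a<m b<m a≡b with ℕ.≤-total a b
  ... | inj₁ a≤b = sym (mod-unique-≤ a≤b b<m (mod-sym a≡b))
  ... | inj₂ b≤a = mod-unique-≤ b≤a a<m a≡b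

  %ℕ-cong : ∀ {z w} m .{{_ : ℕ.NonZero m}} → z ≡ w [mod + m ] → z %ℕ m ≡ w %ℕ m
  %ℕ-cong {z} {w} m z≡w =
    mod-unique (n%ℕd<d z m) (n%ℕd<d w m) (mod-trans (%ℕ-mod z m) (mod-trans z≡w (mod-sym (%ℕ-mod w m))))

  _≡±_[mod_] : ℤ → ℤ → ℤ → Set
  a ≡± b [mod m ] = a ≡ b [mod m ] ⊎ a ≡ - b [mod m ]

  module _ {m : ℤ} where

    ±-sym : ∀ {a b} → a ≡± b [mod m ] → b ≡± a [mod m ]
    ±-sym (inj₁ a≡b) = inj₁ (mod-sym a≡b)
    ±-sym {b = b} (inj₂ a≡-b) =
      inj₂ (mod-sym (mod-trans (neg-cong-mod a≡-b) (mod-reflexive (ℤ.neg-involutive b))))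

    ±-trans : ∀ {a b c} → a ≡± b [mod m ] → b ≡± c [mod m ] → a ≡± c [mod m ]
    ±-trans (inj₁ a≡b) (inj₁ b≡c) = inj₁ (mod-trans a≡b b≡c)
    ±-trans (inj₁ a≡b) (inj₂ b≡-c) = inj₂ (mod-trans a≡b b≡-c)
    ±-trans (inj₂ a≡-b) (inj₁ b≡c) = inj₂ (mod-trans a≡-b (neg-cong-mod b≡c))
    ±-trans {c = c} (inj₂ a≡-b) (inj₂ b≡-c) =
      inj₁ (mod-trans a≡-b (mod-trans (neg-cong-mod b≡-c) (mod-reflexive (ℤ.neg-involutive c))))

    ±-neg : ∀ {a b} → a ≡± b [mod m ] → - a ≡± b [mod m ]
    ±-neg = ±-trans (inj₂ mod-refl)

    ±-*-congˡ : ∀ c {a b} → a ≡± b [mod m ] → c * a ≡± c * b [mod m ]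
    ±-*-congˡ c (inj₁ a≡b) = inj₁ (*-congˡ-mod c a≡b)
    ±-*-congˡ c {b = b} (inj₂ a≡-b) =
      inj₂ (mod-trans (*-congˡ-mod c a≡-b) (mod-reflexive (solve (b ∷ c ∷ []))))

  ±-*-cancel-mod : ∀ {m} c {a b} .{{_ : NonZero c}} → a * c ≡± b * c [mod m * c ] → a ≡± b [mod m ]
  ±-*-cancel-mod c (inj₁ ac≡bc) = inj₁ (*-cancel-mod c ac≡bc)
  ±-*-cancel-mod c {b = b} (inj₂ ac≡-bc) =
    inj₂ (*-cancel-mod c (mod-trans ac≡-bc (mod-reflexive (ℤ.neg-distribˡ-* b c))))

  ±-weaken : ∀ {k m a b} → k ∣ m → a ≡± b [mod m ] → a ≡± b [mod k ]
  ±-weaken k∣m (inj₁ a≡b) = inj₁ (mod-weaken k∣m a≡b)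
  ±-weaken k∣m (inj₂ a≡-b) = inj₂ (mod-weaken k∣m a≡-b)

  ≡±modulus⇒≡0 : ∀ {m a} → a ≡± m [mod m ] → a ≡ + 0 [mod m ]
  ≡±modulus⇒≡0 (inj₁ a≡m) = mod-trans a≡m modulus≡0-mod
  ≡±modulus⇒≡0 (inj₂ a≡-m) = mod-trans a≡-m (neg-cong-mod modulus≡0-mod)

  private
    1≢0 : ¬ (+ 1 ≡ + 0 [mod + 5 ])
    1≢0 = from-no (mod-dec {+ 5} (+ 1) (+ 0))

    1≢-1 : ¬ (+ 1 ≡ - + 1 [mod + 5 ])
    1≢-1 = from-no (mod-dec {+ 5} (+ 1) (- + 1))

  ±1≢0-mod5 : ∀ {z} → z ≡± + 1 [mod + 5 ] → ¬ z ≡ + 0 [mod + 5 ]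
  ±1≢0-mod5 (inj₁ z≡1) z≡0 = 1≢0 (mod-trans (mod-sym z≡1) z≡0)
  ±1≢0-mod5 (inj₂ z≡-1) z≡0 = 1≢0 (neg-cong-mod (mod-trans (mod-sym z≡-1) z≡0))

  1≢-1-mod5 : ∀ {z} → z ≡ + 1 [mod + 5 ] → ¬ z ≡ - + 1 [mod + 5 ]
  1≢-1-mod5 z≡1 z≡-1 = 1≢-1 (mod-trans (mod-sym z≡1) z≡-1)

unique-set-equivalent⇒length≡ : ∀ {A : Set} {xs ys : List A} → Unique xs → Unique ys →
                                (∀ {z} → z ∈ xs ⇔ z ∈ ys) → length xs ≡ length ys
unique-set-equivalent⇒length≡ xs! ys! xs⇔ys = ↭-length (∼bag⇒↭ (unique∧set⇒bag xs! ys! xs⇔ys))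
module Circulant (N' : ℕ) where

  open import Data.Integer.Base using (ℤ; +_; -_; _+_; _-_)
  open Congruence

  N : ℕ
  N = suc N'

  Jump : JumpSet → ℤ → Set
  Jump S z = ∃[ s ] (s ∈ S × z ≡± + s [mod + N ])

  Jump-cong : ∀ {S z w} → z ≡ w [mod + N ] → Jump S z → Jump S w
  Jump-cong z≡w (s , s∈S , z≡±s) = s , s∈S , ±-trans (inj₁ (mod-sym z≡w)) z≡±s

  Jump-neg : ∀ {S z} → Jump S z → Jump S (- z)
  Jump-neg (s , s∈S , z≡±s) = s , s∈S , ±-neg z≡±s

  step⇒diff : ∀ x {y s} → (x ℕ.+ s) % N ≡ y → + y - + x ≡ + s [mod + N ]
  step⇒diff x {s = s} refl =
    mod-shift {b = + x} (mod-trans (%-mod (x ℕ.+ s) N) (mod-reflexive (ℤ.pos-+ x s)))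

  diff⇒step : ∀ x {y s} → y < N → + y - + x ≡ + s [mod + N ] → (x ℕ.+ s) % N ≡ y
  diff⇒step x {y} {s} y<N y-x≡s = mod-unique (ℕ.m%n<n (x ℕ.+ s) N) y<N
    (mod-trans (%-mod (x ℕ.+ s) N)
               (mod-trans (mod-reflexive (ℤ.pos-+ x s)) (mod-sym (mod-unshift {b = + x} y-x≡s))))

  Adj⇒Jump : ∀ {S x y} → Adj N S x y → Jump S (+ y - + x)
  Adj⇒Jump {x = x} (s , s∈S , inj₁ x+s≡y) = s , s∈S , inj₁ (step⇒diff x x+s≡y)
  Adj⇒Jump {x = x} {y} (s , s∈S , inj₂ y+s≡x) =
    s , s∈S , inj₂ (mod-swap {a = + x} {+ y} (step⇒diff y y+s≡x))

  Jump⇒Adj : ∀ {S x y} → x < N → y < N → Jump S (+ y - + x) → Adj N S x y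
  Jump⇒Adj {x = x} x<N y<N (s , s∈S , inj₁ y-x≡s) = s , s∈S , inj₁ (diff⇒step x y<N y-x≡s)
  Jump⇒Adj {x = x} {y} x<N y<N (s , s∈S , inj₂ y-x≡-s) =
    s , s∈S , inj₂ (diff⇒step y x<N (mod-swap⁻ {a = + y} {+ x} y-x≡-s))

  private
    h : ℕ
    h = N / 2

    N≡r+h+h : N ≡ N % 2 ℕ.+ (h ℕ.+ h)
    N≡r+h+h = trans (ℕ.m≡m%n+[m/n]*n N 2)
                    (cong (N % 2 ℕ.+_) (trans (ℕ.*-comm h 2) (cong (h ℕ.+_) (ℕ.+-identityʳ h))))

    h+h≤N : h ℕ.+ h ℕ.≤ N
    h+h≤N = subst (h ℕ.+ h ℕ.≤_) (sym N≡r+h+h) (ℕ.m≤n+m (h ℕ.+ h) (N % 2))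

    N≤1+h+h : N ℕ.≤ suc (h ℕ.+ h)
    N≤1+h+h = subst (ℕ._≤ suc (h ℕ.+ h)) (sym N≡r+h+h)
                    (ℕ.+-monoˡ-≤ (h ℕ.+ h) (ℕ.s≤s⁻¹ (ℕ.m%n<n N 2)))

    h<N : h < N
    h<N = ℕ.m/n<m N 2 (s≤s (s≤s z≤n))

    ≤h-sum : ∀ {a b} → a ℕ.≤ h → b ℕ.≤ h → a ℕ.+ b ≡ N → a ≡ h
    ≤h-sum {a} {b} a≤h b≤h a+b≡N = ℕ.≤-antisym a≤h (ℕ.+-cancelʳ-≤ b h a (begin
      h ℕ.+ b  ≤⟨ ℕ.+-monoʳ-≤ h b≤h ⟩
      h ℕ.+ h  ≤⟨ h+h≤N ⟩
      N        ≡⟨ sym a+b≡N ⟩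
      a ℕ.+ b  ∎))
      where open ℕ.≤-Reasoning

  red-≤ : ∀ s → red N s ℕ.≤ h
  red-≤ s with s % N ℕ.≤ᵇ h in eq
  ... | true = ℕ.≤ᵇ⇒≤ (s % N) h (subst T (sym eq) _)
  ... | false = ℕ.m≤n+o⇒m∸n≤o N (s % N) (ℕ.≤-trans N≤1+h+h (ℕ.+-monoˡ-≤ h h<s%N))
    where
    h<s%N : h < s % N
    h<s%N = ℕ.≰⇒> (λ s%N≤h → subst T eq (ℕ.≤⇒≤ᵇ s%N≤h))

  red-≡± : ∀ s → + red N s ≡± + s [mod + N ]
  red-≡± s with s % N ℕ.≤ᵇ h
  ... | true = inj₁ (%-mod s N)
  ... | false = inj₂ (begin
    + (N ∸ s % N)     ≡⟨ pos-∸ (ℕ.<⇒≤ (ℕ.m%n<n s N)) ⟩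
    + N - + (s % N)   ≈⟨ +-cong-mod modulus≡0-mod (neg-cong-mod (%-mod s N)) ⟩
    + 0 - + s         ≡⟨ ℤ.+-identityˡ (- + s) ⟩
    - + s             ∎)
    where open ModReasoning (+ N)

  ≤h-unique : ∀ {a b} → a ℕ.≤ h → b ℕ.≤ h → + a ≡± + b [mod + N ] → a ≡ b
  ≤h-unique a≤h b≤h (inj₁ a≡b) = mod-unique (ℕ.≤-<-trans a≤h h<N) (ℕ.≤-<-trans b≤h h<N) a≡b
  ≤h-unique {a} {b} a≤h b≤h (inj₂ a≡-b)
    with ℕ.m≤n⇒m<n∨m≡n (ℕ.≤-trans (ℕ.+-mono-≤ a≤h b≤h) h+h≤N)
  ... | inj₁ a+b<N = trans (ℕ.m+n≡0⇒m≡0 a a+b≡0) (sym (ℕ.m+n≡0⇒n≡0 a a+b≡0))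
    where
    a+b≡0 : a ℕ.+ b ≡ 0
    a+b≡0 = mod-unique a+b<N (s≤s z≤n) (mod-trans (mod-reflexive (ℤ.pos-+ a b))
              (mod-trans (+-cong-mod a≡-b (mod-refl {a = + b})) (mod-reflexive (ℤ.+-inverseˡ (+ b)))))
  ... | inj₂ a+b≡N =
    trans (≤h-sum a≤h b≤h a+b≡N) (sym (≤h-sum b≤h a≤h (trans (ℕ.+-comm b a) a+b≡N)))

  red-≡⇔ : ∀ {a b} → (red N a ≡ red N b) ⇔ (+ a ≡± + b [mod + N ])
  red-≡⇔ {a} {b} = mk⇔
    (λ ra≡rb → ±-trans (±-sym (red-≡± a))
                       (subst (λ r → + r ≡± + b [mod + N ]) (sym ra≡rb) (red-≡± b)))
    (λ a≡±b → ≤h-unique (red-≤ a) (red-≤ b)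
                        (±-trans (red-≡± a) (±-trans a≡±b (±-sym (red-≡± b)))))

  SetEq-refl : ∀ {S} → SetEq N S S
  SetEq-refl _ = ⇔.refl

  SetEq-sym : ∀ {S T} → SetEq N S T → SetEq N T S
  SetEq-sym S≅T r = ⇔.sym (S≅T r)

  SetEq-trans : ∀ {S T U} → SetEq N S T → SetEq N T U → SetEq N S U
  SetEq-trans S≅T T≅U r = ⇔.trans (S≅T r) (T≅U r)

  SetEq⇒Jump : ∀ {S T z} → SetEq N S T → Jump S z → Jump T z
  SetEq⇒Jump S≅T (s , s∈S , z≡±s)
    with ∈-map⁻ (red N) (Equivalence.to (S≅T (red N s)) (∈-map⁺ (red N) s∈S))
  ... | t , t∈T , rs≡rt = t , t∈T , ±-trans z≡±s (Equivalence.to red-≡⇔ rs≡rt)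

  SetEq⇒Adj : ∀ {S T x y} → x < N → y < N → SetEq N S T → Adj N S x y → Adj N T x y
  SetEq⇒Adj x<N y<N S≅T = Jump⇒Adj x<N y<N ∘ SetEq⇒Jump S≅T ∘ Adj⇒Jump

  ImgEq-resp-SetEq : ∀ {m t R S T} → SetEq N S T → ImgEq N m t R S → ImgEq N m t R T
  ImgEq-resp-SetEq S≅T img a b a<N b<N =
    ⇔.trans (img a b a<N b<N) (mk⇔ (SetEq⇒Adj a<N b<N S≅T) (SetEq⇒Adj a<N b<N (SetEq-sym S≅T)))

  private
    0<N : 0 < N
    0<N = s≤s z≤n

    red<N : ∀ s → red N s < N
    red<N s = ℕ.≤-<-trans (red-≤ s) h<N

    red-jump : ∀ {S s} → s ∈ S → Jump S (+ red N s - + 0)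
    red-jump {s = s} s∈S =
      s , s∈S , ±-trans (inj₁ (mod-reflexive (ℤ.+-identityʳ (+ red N s)))) (red-≡± s)

    jump-red : ∀ {T s} → Jump T (+ red N s - + 0) → red N s ∈ map (red N) T
    jump-red {T} {s} (t , t∈T , rs≡±t) =
      subst (_∈ map (red N) T) (sym (Equivalence.from (red-≡⇔ {s} {t}) s≡±t)) (∈-map⁺ (red N) t∈T)
      where
      s≡±t : + s ≡± + t [mod + N ]
      s≡±t = ±-trans (±-sym (red-≡± s))
                     (±-trans (inj₁ (mod-reflexive (sym (ℤ.+-identityʳ (+ red N s))))) rs≡±t)

    Adj⇒red⊆ : ∀ {S T} → (∀ {x y} → x < N → y < N → Adj N S x y → Adj N T x y) →
               ∀ {r} → r ∈ map (red N) S → r ∈ map (red N) T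
    Adj⇒red⊆ S⇒T r∈ with ∈-map⁻ (red N) r∈
    ... | s , s∈S , refl =
      jump-red {s = s} (Adj⇒Jump (S⇒T 0<N (red<N s) (Jump⇒Adj 0<N (red<N s) (red-jump s∈S))))

  Adj⇔⇒SetEq : ∀ {S T} → (∀ x y → x < N → y < N → Adj N S x y ⇔ Adj N T x y) → SetEq N S T
  Adj⇔⇒SetEq S⇔T r = mk⇔ (Adj⇒red⊆ (λ x<N y<N → Equivalence.to (S⇔T _ _ x<N y<N)))
                         (Adj⇒red⊆ (λ x<N y<N → Equivalence.from (S⇔T _ _ x<N y<N)))

  ImgEq⇒SetEq : ∀ {m t R S T} → ImgEq N m t R S → ImgEq N m t R T → SetEq N S T
  ImgEq⇒SetEq img₁ img₂ =
    Adj⇔⇒SetEq (λ a b a<N b<N → ⇔.trans (⇔.sym (img₁ a b a<N b<N)) (img₂ a b a<N b<N))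

  card-resp-SetEq : ∀ {S T} → SetEq N S T → card N S ≡ card N T
  card-resp-SetEq S≅T = unique-set-equivalent⇒length≡ (deduplicate-! _) (deduplicate-! _)
    (λ {r} → ⇔.trans (⇔.sym (deduplicate-∈⇔ ℕ._≟_)) (⇔.trans (S≅T r) (deduplicate-∈⇔ ℕ._≟_)))

  card-≡-length : ∀ {S} → Unique (map (red N) S) → card N S ≡ length S
  card-≡-length {S} S! = trans
    (unique-set-equivalent⇒length≡ (deduplicate-! _) S! (⇔.sym (deduplicate-∈⇔ ℕ._≟_)))
    (length-map (red N) S)

module ThetaMap (N' m' : ℕ) (m∣N : suc m' ℕ.∣ suc N') (t : ℕ) where

  open import Data.Integer.Base using (ℤ; +_; -_; _+_; _-_; _*_)
  open Congruence
  open Circulant N'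

  m : ℕ
  m = suc m'

  F : ℤ
  F = + m * + t

  θ-≡ : ∀ x → + θ N m t x ≡ + x + + (x % m) * F [mod + N ]
  θ-≡ x = mod-trans (%-mod (x ℕ.+ x % m ℕ.* m ℕ.* t) N) (mod-reflexive (begin
    + (x ℕ.+ x % m ℕ.* m ℕ.* t)          ≡⟨ ℤ.pos-+ x (x % m ℕ.* m ℕ.* t) ⟩
    + x + + (x % m ℕ.* m ℕ.* t)          ≡⟨ cong (_+_ (+ x)) (ℤ.pos-* (x % m ℕ.* m) t) ⟩
    + x + + (x % m ℕ.* m) * + t          ≡⟨ cong (λ v → + x + v * + t) (ℤ.pos-* (x % m) m) ⟩
    + x + + (x % m) * + m * + t          ≡⟨ cong (_+_ (+ x)) (ℤ.*-assoc (+ (x % m)) (+ m) (+ t)) ⟩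
    + x + + (x % m) * F                  ∎))
    where open ≡-Reasoning

  θ<N : ∀ x → θ N m t x < N
  θ<N x = ℕ.m%n<n (x ℕ.+ x % m ℕ.* m ℕ.* t) N

  θ-≡-mod-m : ∀ x → + θ N m t x ≡ + x [mod + m ]
  θ-≡-mod-m x =
    mod-trans (mod-weaken (∣ᵤ⇒∣ m∣N) (θ-≡ x)) (+-absorbʳ-mod (*-multiple≡0-mod (+ (x % m)) (+ t)))

  θ-diff : ∀ x y → + θ N m t y - + θ N m t x ≡ (+ y - + x) + (+ (y % m) - + (x % m)) * F [mod + N ]
  θ-diff x y = mod-trans (+-cong-mod (θ-≡ y) (neg-cong-mod (θ-≡ x)))
                         (mod-reflexive (regroup (+ y) (+ x) (+ (y % m)) (+ (x % m)) F))
    where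
    regroup : ∀ a b c d f → (a + c * f) - (b + d * f) ≡ (a - b) + (c - d) * f
    regroup a b c d f = solve (a ∷ b ∷ c ∷ d ∷ f ∷ [])

  θ-diff-residues : ∀ x y {r r'} → x % m ≡ r → y % m ≡ r' →
                    + θ N m t y - + θ N m t x ≡ (+ y - + x) + (+ r' - + r) * F [mod + N ]
  θ-diff-residues x y refl refl = θ-diff x y

  θ-diff-≡-mod-m : ∀ x y → + θ N m t y - + θ N m t x ≡ + y - + x [mod + m ]
  θ-diff-≡-mod-m x y = +-cong-mod (θ-≡-mod-m y) (neg-cong-mod (θ-≡-mod-m x))

  θ-diff-multiple-of-m : ∀ x y → + y - + x ≡ + 0 [mod + m ] →
                         + θ N m t y - + θ N m t x ≡ + y - + x [mod + N ]
  θ-diff-multiple-of-m x y y-x≡0 = mod-trans (θ-diff x y) (mod-reflexive (begin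
    (+ y - + x) + (+ (y % m) - + (x % m)) * F   ≡⟨ cong (λ r → (+ y - + x) + (+ r - + (x % m)) * F) y%m≡x%m ⟩
    (+ y - + x) + (+ (x % m) - + (x % m)) * F   ≡⟨ cancel (+ y - + x) (+ (x % m)) F ⟩
    + y - + x                                   ∎))
    where
    open ≡-Reasoning
    y%m≡x%m : y % m ≡ x % m
    y%m≡x%m = mod-unique (ℕ.m%n<n y m) (ℕ.m%n<n x m)
      (mod-trans (%-mod y m) (mod-trans (mod-diff≡0 {b = + x} y-x≡0) (mod-sym (%-mod x m))))
    cancel : ∀ a b f → a + (b - b) * f ≡ a
    cancel a b f = solve (a ∷ b ∷ f ∷ [])

  θ-diff-mod : ∀ {K} x y c → K ∣ + N → K ∣ + m * F → + y - + x ≡ c [mod + m ] →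
               + θ N m t y - + θ N m t x ≡ (+ y - + x) + c * F [mod K ]
  θ-diff-mod {K} x y c K∣N K∣mF y-x≡c = mod-trans (mod-weaken K∣N (θ-diff x y))
    (+-cong-mod (mod-refl {a = + y - + x}) (mod-weaken K∣mF (*-scale-mod F (mod-trans residues≡y-x y-x≡c))))
    where
    residues≡y-x : + (y % m) - + (x % m) ≡ + y - + x [mod + m ]
    residues≡y-x = +-cong-mod (%-mod y m) (neg-cong-mod (%-mod x m))

  θ-surjective : ∀ {a} → a < N → ∃[ x ] (x < N × θ N m t x ≡ a)
  θ-surjective {a} a<N = x , n%ℕd<d v N , mod-unique (θ<N x) a<N θx≡a
    where
    v : ℤ
    v = + a - + (a % m) * F
    x : ℕ
    x = v %ℕ N
    x≡v : + x ≡ v [mod + N ]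
    x≡v = %ℕ-mod v N
    x%m≡a%m : x % m ≡ a % m
    x%m≡a%m = mod-unique (ℕ.m%n<n x m) (ℕ.m%n<n a m) (mod-trans (%-mod x m) (mod-trans
      (mod-weaken (∣ᵤ⇒∣ m∣N) x≡v)
      (mod-trans (-‿absorbʳ-mod (*-multiple≡0-mod (+ (a % m)) (+ t))) (mod-sym (%-mod a m)))))
    θx≡a : + θ N m t x ≡ + a [mod + N ]
    θx≡a = begin
      + θ N m t x               ≈⟨ θ-≡ x ⟩
      + x + + (x % m) * F       ≡⟨ cong (λ r → + x + + r * F) x%m≡a%m ⟩
      + x + + (a % m) * F       ≈⟨ +-cong-mod x≡v mod-refl ⟩
      v + + (a % m) * F         ≡⟨ cancel (+ a) (+ (a % m) * F) ⟩
      + a                       ∎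
      where
      open ModReasoning (+ N)
      cancel : ∀ a b → (a - b) + b ≡ a
      cancel a b = solve (a ∷ b ∷ [])

  ImgEq-intro : ∀ {R S} → (∀ x y → Jump R (+ y - + x) ⇔ Jump S (+ θ N m t y - + θ N m t x)) →
                ImgEq N m t R S
  ImgEq-intro {R} {S} R⇔S a b a<N b<N = mk⇔
    (λ { (x , y , _ , _ , x~y , refl , refl) →
         Jump⇒Adj (θ<N x) (θ<N y) (Equivalence.to (R⇔S x y) (Adj⇒Jump x~y)) })
    (preimage (θ-surjective a<N) (θ-surjective b<N))
    where
    preimage : ∃[ x ] (x < N × θ N m t x ≡ a) → ∃[ y ] (y < N × θ N m t y ≡ b) →
               Adj N S a b → ImgAdj N m t R a b
    preimage (x , x<N , refl) (y , y<N , refl) a~b =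
      x , y , x<N , y<N , Jump⇒Adj x<N y<N (Equivalence.from (R⇔S x y) (Adj⇒Jump a~b)) , refl , refl

module Family (n' : ℕ) where

  open import Data.Integer.Base using (ℤ; +_; -_; _+_; _-_; _*_)
  open Congruence

  n : ℕ
  n = suc n'

  M : ℕ
  M = 25 ℕ.* n

  -- N' is chosen so that N = suc N' is definitionally 125 * n: the _mod_ and _div_ of
  -- Defs only compute on a modulus of the form suc _.
  open Circulant (n' ℕ.+ 124 ℕ.* n) public

  5∣ℕN : 5 ℕ.∣ N
  5∣ℕN = ℕ.divides M (trans (ℕ.*-assoc 5 25 n) (ℕ.*-comm 5 M))

  module Θ = ThetaMap (n' ℕ.+ 124 ℕ.* n) 4 5∣ℕN

  N≡5*M : + N ≡ + 5 * + M
  N≡5*M = trans (cong +_ (ℕ.*-assoc 5 25 n)) (ℤ.pos-* 5 M)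

  M∣N : + M ∣ + N
  M∣N = divides (+ 5) N≡5*M

  5∣M : + 5 ∣ + M
  5∣M = ∣ᵤ⇒∣ (ℕ.∣-trans (ℕ.divides 5 refl) (ℕ.m∣m*n n))

  5∣N : + 5 ∣ + N
  5∣N = ∣-trans 5∣M M∣N

  jumps : ℕ → JumpSet
  jumps δ = 5 ∷ δ ∷ (M ∸ δ) ∷ (M ℕ.+ δ) ∷ (50 ℕ.* n ∸ δ) ∷ (50 ℕ.* n ℕ.+ δ) ∷ []

  JumpClass : ℕ → ℤ → Set
  JumpClass δ z = z ≡± + 5 [mod + N ] ⊎ z ≡± + δ [mod + M ]

  ≡±5⇒≡0 : ∀ {z} → z ≡± + 5 [mod + N ] → z ≡ + 0 [mod + 5 ]
  ≡±5⇒≡0 z≡±5 = ≡±modulus⇒≡0 (±-weaken 5∣N z≡±5)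

  module _ {δ : ℕ} (δ≡1 : + δ ≡ + 1 [mod + 5 ]) where

    ≡±δ⇒≡±1 : ∀ {z} → z ≡± + δ [mod + M ] → z ≡± + 1 [mod + 5 ]
    ≡±δ⇒≡±1 z≡±δ = ±-trans (±-weaken 5∣M z≡±δ) (inj₁ δ≡1)

    JumpClass-neg : ∀ {z} → JumpClass δ z → JumpClass δ (- z)
    JumpClass-neg (inj₁ z≡±5) = inj₁ (±-neg z≡±5)
    JumpClass-neg (inj₂ z≡±δ) = inj₂ (±-neg z≡±δ)

    JumpClass-≡0 : ∀ {z} → JumpClass δ z → z ≡ + 0 [mod + 5 ] → z ≡± + 5 [mod + N ]
    JumpClass-≡0 (inj₁ z≡±5) _ = z≡±5
    JumpClass-≡0 (inj₂ z≡±δ) z≡0 = ⊥-elim (±1≢0-mod5 (≡±δ⇒≡±1 z≡±δ) z≡0)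

    JumpClass-≡1 : ∀ {z} → JumpClass δ z → z ≡ + 1 [mod + 5 ] → z ≡ + δ [mod + M ]
    JumpClass-≡1 (inj₁ z≡±5) z≡1 = ⊥-elim (±1≢0-mod5 (inj₁ z≡1) (≡±5⇒≡0 z≡±5))
    JumpClass-≡1 (inj₂ (inj₁ z≡δ)) _ = z≡δ
    JumpClass-≡1 (inj₂ (inj₂ z≡-δ)) z≡1 =
      ⊥-elim (1≢-1-mod5 z≡1 (mod-trans (mod-weaken 5∣M z≡-δ) (neg-cong-mod δ≡1)))

    JumpClass-≡±1 : ∀ {z} → JumpClass δ z → z ≡± + 1 [mod + 5 ] → z ≡± + δ [mod + M ]
    JumpClass-≡±1 z∈δ (inj₁ z≡1) = inj₁ (JumpClass-≡1 z∈δ z≡1)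
    JumpClass-≡±1 {z} z∈δ (inj₂ z≡-1) =
      inj₂ (mod-trans (mod-reflexive (sym (ℤ.neg-involutive z)))
                      (neg-cong-mod (JumpClass-≡1 (JumpClass-neg z∈δ) (neg-cong-mod z≡-1))))

  module Jumps {δ : ℕ} (δ≤M : δ ℕ.≤ M) (δ≡1 : + δ ≡ + 1 [mod + 5 ]) where

    private
      -- Besides 5, jumps δ consists of ±(δ + r M) mod N for r = 0, 4, 1, 3, 2: one
      -- representative for each lift of δ from ℤ/M to ℤ/N.
      lift : ℕ → ℤ
      lift r = + δ + + r * + M

      lift≡δ : ∀ r → lift r ≡ + δ [mod + M ]
      lift≡δ r = +-absorbʳ-mod (multiple≡0-mod (+ r))

      lift≡1 : ∀ r → lift r ≡ + 1 [mod + 5 ]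
      lift≡1 r = mod-trans (mod-weaken 5∣M (lift≡δ r)) δ≡1

      ≡-mod-N : ∀ {a b} q → a ≡ b + q * (+ 5 * + M) → a ≡ b [mod + N ]
      ≡-mod-N q a≡b+qN = mod-resp-modulus (sym N≡5*M) (≡+multiple⇒≡-mod q a≡b+qN)

      50n≡2*M : + (50 ℕ.* n) ≡ + 2 * + M
      50n≡2*M = trans (cong +_ (ℕ.*-assoc 2 25 n)) (ℤ.pos-* 2 M)

      δ≤50n : δ ℕ.≤ 50 ℕ.* n
      δ≤50n = ℕ.≤-trans δ≤M (ℕ.*-monoˡ-≤ n {25} {50} (ℕ.m≤m+n 25 25))

      lift₀ : + δ ≡± lift 0 [mod + N ]
      lift₀ = inj₁ (mod-reflexive (sym (ℤ.+-identityʳ (+ δ))))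

      lift₁ : + (M ℕ.+ δ) ≡± lift 1 [mod + N ]
      lift₁ = inj₁ (mod-reflexive (trans (ℤ.pos-+ M δ) (regroup (+ M) (+ δ))))
        where
        regroup : ∀ a b → a + b ≡ b + + 1 * a
        regroup a b = solve (a ∷ b ∷ [])

      lift₂ : + (50 ℕ.* n ℕ.+ δ) ≡± lift 2 [mod + N ]
      lift₂ = inj₁ (mod-reflexive
        (trans (ℤ.pos-+ (50 ℕ.* n) δ) (trans (cong (_+ + δ) 50n≡2*M) (regroup (+ M) (+ δ)))))
        where
        regroup : ∀ a b → + 2 * a + b ≡ b + + 2 * a
        regroup a b = solve (a ∷ b ∷ [])

      lift₃ : + (50 ℕ.* n ∸ δ) ≡± lift 3 [mod + N ]
      lift₃ = inj₂ (≡-mod-N (+ 1)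
        (trans (pos-∸ δ≤50n) (trans (cong (_- + δ) 50n≡2*M) (regroup (+ M) (+ δ)))))
        where
        regroup : ∀ a b → + 2 * a - b ≡ - (b + + 3 * a) + + 1 * (+ 5 * a)
        regroup a b = solve (a ∷ b ∷ [])

      lift₄ : + (M ∸ δ) ≡± lift 4 [mod + N ]
      lift₄ = inj₂ (≡-mod-N (+ 1) (trans (pos-∸ δ≤M) (regroup (+ M) (+ δ))))
        where
        regroup : ∀ a b → a - b ≡ - (b + + 4 * a) + + 1 * (+ 5 * a)
        regroup a b = solve (a ∷ b ∷ [])

      lift-jump : ∀ r → r < 5 → Jump (jumps δ) (lift r)
      lift-jump 0 _ = _ , there (here refl) , ±-sym lift₀
      lift-jump 1 _ = _ , there (there (there (here refl))) , ±-sym lift₁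
      lift-jump 2 _ = _ , there (there (there (there (there (here refl))))) , ±-sym lift₂
      lift-jump 3 _ = _ , there (there (there (there (here refl)))) , ±-sym lift₃
      lift-jump 4 _ = _ , there (there (here refl)) , ±-sym lift₄
      lift-jump (suc (suc (suc (suc (suc _))))) (s≤s (s≤s (s≤s (s≤s (s≤s ())))))

      ≡δ⇒≡lift : ∀ {z} → z ≡ + δ [mod + M ] → ∃[ r ] (r < 5 × z ≡ lift r [mod + N ])
      ≡δ⇒≡lift {z} (mod-divides (divides q z-δ≡qM)) = q %ℕ 5 , n%ℕd<d q 5 , ≡-mod-N (q /ℕ 5) (begin
        z                                           ≡⟨ split z (+ δ) ⟩
        (z - + δ) + + δ                             ≡⟨ cong (_+ + δ) z-δ≡qM ⟩
        q * + M + + δ                               ≡⟨ cong (λ v → v * + M + + δ) (a≡a%ℕn+[a/ℕn]*n q 5) ⟩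
        (+ (q %ℕ 5) + (q /ℕ 5) * + 5) * + M + + δ   ≡⟨ regroup (+ (q %ℕ 5)) (q /ℕ 5) (+ M) (+ δ) ⟩
        lift (q %ℕ 5) + (q /ℕ 5) * (+ 5 * + M)      ∎)
        where
        open ≡-Reasoning
        split : ∀ a b → a ≡ (a - b) + b
        split a b = solve (a ∷ b ∷ [])
        regroup : ∀ r k m d → (r + k * + 5) * m + d ≡ (d + r * m) + k * (+ 5 * m)
        regroup r k m d = solve (r ∷ k ∷ m ∷ d ∷ [])

      ≡±lift⇒≡±δ : ∀ {z} r → z ≡± lift r [mod + N ] → z ≡± + δ [mod + M ]
      ≡±lift⇒≡±δ r z≡±lift = ±-trans (±-weaken M∣N z≡±lift) (inj₁ (lift≡δ r))

      ≡δ⇒Jump : ∀ {z} → z ≡ + δ [mod + M ] → Jump (jumps δ) z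
      ≡δ⇒Jump z≡δ =
        let (r , r<5 , z≡lift) = ≡δ⇒≡lift z≡δ in Jump-cong (mod-sym z≡lift) (lift-jump r r<5)

      Jump⇒class : ∀ {z} → Jump (jumps δ) z → JumpClass δ z
      Jump⇒class (_ , here refl , z≡±5) = inj₁ z≡±5
      Jump⇒class (_ , there (here refl) , z≡±s) = inj₂ (≡±lift⇒≡±δ 0 (±-trans z≡±s lift₀))
      Jump⇒class (_ , there (there (here refl)) , z≡±s) =
        inj₂ (≡±lift⇒≡±δ 4 (±-trans z≡±s lift₄))
      Jump⇒class (_ , there (there (there (here refl))) , z≡±s) =
        inj₂ (≡±lift⇒≡±δ 1 (±-trans z≡±s lift₁))
      Jump⇒class (_ , there (there (there (there (here refl)))) , z≡±s) =
        inj₂ (≡±lift⇒≡±δ 3 (±-trans z≡±s lift₃))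
      Jump⇒class (_ , there (there (there (there (there (here refl))))) , z≡±s) =
        inj₂ (≡±lift⇒≡±δ 2 (±-trans z≡±s lift₂))

      class⇒Jump : ∀ {z} → JumpClass δ z → Jump (jumps δ) z
      class⇒Jump (inj₁ z≡±5) = 5 , here refl , z≡±5
      class⇒Jump (inj₂ (inj₁ z≡δ)) = ≡δ⇒Jump z≡δ
      class⇒Jump {z} (inj₂ (inj₂ z≡-δ)) = Jump-cong (mod-reflexive (ℤ.neg-involutive z))
        (Jump-neg (≡δ⇒Jump (mod-trans (neg-cong-mod z≡-δ) (mod-reflexive (ℤ.neg-involutive (+ δ))))))

      five-apart : ∀ r {b} → + b ≡± lift r [mod + N ] → ¬ (+ 5 ≡± + b [mod + N ])
      five-apart r b≡±lift 5≡±b =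
        ±1≢0-mod5 (±-trans (±-weaken 5∣N (±-trans 5≡±b b≡±lift)) (inj₁ (lift≡1 r))) modulus≡0-mod

      -- The side condition r ≢ r' (mod 5) is an implicit argument discharged by evaluating mod-dec.
      lifts-apart : ∀ r r' {_ : False (mod-dec {+ 5} (+ r) (+ r'))} {a b} →
                    + a ≡± lift r [mod + N ] → + b ≡± lift r' [mod + N ] → ¬ (+ a ≡± + b [mod + N ])
      lifts-apart r r' {r≢r'} a≡±lift b≡±lift a≡±b =
        apart (±-trans (±-sym a≡±lift) (±-trans a≡±b b≡±lift))
        where
        apart : ¬ (lift r ≡± lift r' [mod + N ])
        apart (inj₁ lr≡lr') = toWitnessFalse r≢r'
          (*-cancel-mod (+ M) (mod-resp-modulus N≡5*M (+-cancelˡ-mod (+ δ) lr≡lr')))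
        apart (inj₂ lr≡-lr') =
          1≢-1-mod5 (lift≡1 r) (mod-trans (mod-weaken 5∣N lr≡-lr') (neg-cong-mod (lift≡1 r')))

      jumps-distinct : AllPairs (λ a b → ¬ (+ a ≡± + b [mod + N ])) (jumps δ)
      jumps-distinct =
          (five-apart 0 lift₀ All.∷ five-apart 4 lift₄ All.∷ five-apart 1 lift₁ All.∷
           five-apart 3 lift₃ All.∷ five-apart 2 lift₂ All.∷ All.[])
        AllPairs.∷ (lifts-apart 0 4 lift₀ lift₄ All.∷ lifts-apart 0 1 lift₀ lift₁ All.∷
                    lifts-apart 0 3 lift₀ lift₃ All.∷ lifts-apart 0 2 lift₀ lift₂ All.∷ All.[])
        AllPairs.∷ (lifts-apart 4 1 lift₄ lift₁ All.∷ lifts-apart 4 3 lift₄ lift₃ All.∷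
                    lifts-apart 4 2 lift₄ lift₂ All.∷ All.[])
        AllPairs.∷ (lifts-apart 1 3 lift₁ lift₃ All.∷ lifts-apart 1 2 lift₁ lift₂ All.∷ All.[])
        AllPairs.∷ (lifts-apart 3 2 lift₃ lift₂ All.∷ All.[])
        AllPairs.∷ All.[]
        AllPairs.∷ AllPairs.[]

    Jump-jumps⇔ : ∀ {z} → Jump (jumps δ) z ⇔ JumpClass δ z
    Jump-jumps⇔ = mk⇔ Jump⇒class class⇒Jump

    card-jumps : card N (jumps δ) ≡ 6
    card-jumps = card-≡-length {jumps δ} (AllPairs.map⁺ {xs = jumps δ}
      (AllPairs.map (λ {a} {b} a≢±b → a≢±b ∘ Equivalence.to (red-≡⇔ {a} {b})) jumps-distinct))
  module _ {δ δ' k : ℕ} (δ≤M : δ ℕ.≤ M) (δ'≤M : δ' ℕ.≤ M) (δ≡1 : + δ ≡ + 1 [mod + 5 ])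
           (δ'≡δ+F : + δ' ≡ + δ + + 5 * + (n ℕ.* k) [mod + M ]) where

    open Θ (n ℕ.* k)

    private
      τ : ℕ → ℕ
      τ = θ N 5 (n ℕ.* k)

      M∣5F : + M ∣ + 5 * F
      M∣5F = divides (+ k) (begin
        + 5 * (+ 5 * + (n ℕ.* k))   ≡⟨ cong (λ v → + 5 * (+ 5 * v)) (ℤ.pos-* n k) ⟩
        + 5 * (+ 5 * (+ n * + k))   ≡⟨ regroup (+ n) (+ k) ⟩
        + k * (+ 25 * + n)          ≡⟨ cong (+ k *_) (ℤ.pos-* 25 n) ⟨
        + k * + M                   ∎)
        where
        open ≡-Reasoning
        regroup : ∀ a b → + 5 * (+ 5 * (a * b)) ≡ b * (+ 25 * a)
        regroup a b = solve (a ∷ b ∷ [])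

      δ'≡1 : + δ' ≡ + 1 [mod + 5 ]
      δ'≡1 = mod-trans (mod-weaken 5∣M δ'≡δ+F)
                       (mod-trans (+-absorbʳ-mod (multipleˡ≡0-mod (+ (n ℕ.* k)))) δ≡1)

      ≡1⇒θ-diff : ∀ x y → + y - + x ≡ + 1 [mod + 5 ] → + τ y - + τ x ≡ (+ y - + x) + F [mod + M ]
      ≡1⇒θ-diff x y y-x≡1 = mod-trans (θ-diff-mod x y (+ 1) M∣N M∣5F y-x≡1)
        (mod-reflexive (cong (_+_ (+ y - + x)) (ℤ.*-identityˡ F)))

      δ-step : ∀ x y → + y - + x ≡ + δ [mod + M ] → + τ y - + τ x ≡ + δ' [mod + M ]
      δ-step x y y-x≡δ = mod-trans (≡1⇒θ-diff x y (mod-trans (mod-weaken 5∣M y-x≡δ) δ≡1))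
        (mod-trans (+-cong-mod y-x≡δ mod-refl) (mod-sym δ'≡δ+F))

      δ-step⁻¹ : ∀ x y → + τ y - + τ x ≡ + δ' [mod + M ] → + y - + x ≡ + δ [mod + M ]
      δ-step⁻¹ x y w≡δ' =
        +-cancelʳ-mod F (mod-trans (mod-sym (≡1⇒θ-diff x y y-x≡1)) (mod-trans w≡δ' δ'≡δ+F))
        where
        y-x≡1 : + y - + x ≡ + 1 [mod + 5 ]
        y-x≡1 = mod-trans (mod-sym (θ-diff-≡-mod-m x y)) (mod-trans (mod-weaken 5∣M w≡δ') δ'≡1)

      five-step : ∀ x y → + y - + x ≡± + 5 [mod + N ] → + τ y - + τ x ≡± + 5 [mod + N ]
      five-step x y y-x≡±5 = ±-trans (inj₁ (θ-diff-multiple-of-m x y (≡±5⇒≡0 y-x≡±5))) y-x≡±5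

      five-step⁻¹ : ∀ x y → + τ y - + τ x ≡± + 5 [mod + N ] → + y - + x ≡± + 5 [mod + N ]
      five-step⁻¹ x y w≡±5 = ±-trans (inj₁ (mod-sym (θ-diff-multiple-of-m x y y-x≡0))) w≡±5
        where
        y-x≡0 : + y - + x ≡ + 0 [mod + 5 ]
        y-x≡0 = mod-trans (mod-sym (θ-diff-≡-mod-m x y)) (≡±5⇒≡0 w≡±5)

      θ-JumpClass : ∀ x y → JumpClass δ (+ y - + x) ⇔ JumpClass δ' (+ τ y - + τ x)
      θ-JumpClass x y = mk⇔ to from
        where
        to : JumpClass δ (+ y - + x) → JumpClass δ' (+ τ y - + τ x)
        to (inj₁ y-x≡±5) = inj₁ (five-step x y y-x≡±5)
        to (inj₂ (inj₁ y-x≡δ)) = inj₂ (inj₁ (δ-step x y y-x≡δ))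
        to (inj₂ (inj₂ y-x≡-δ)) =
          inj₂ (inj₂ (mod-swap {a = + τ x} {+ τ y} (δ-step y x (mod-swap⁻ {a = + y} {+ x} y-x≡-δ))))
        from : JumpClass δ' (+ τ y - + τ x) → JumpClass δ (+ y - + x)
        from (inj₁ w≡±5) = inj₁ (five-step⁻¹ x y w≡±5)
        from (inj₂ (inj₁ w≡δ')) = inj₂ (inj₁ (δ-step⁻¹ x y w≡δ'))
        from (inj₂ (inj₂ w≡-δ')) =
          inj₂ (inj₂ (mod-swap {a = + x} {+ y} (δ-step⁻¹ y x (mod-swap⁻ {a = + τ y} {+ τ x} w≡-δ'))))

    θ-jumps : ImgEq N 5 (n ℕ.* k) (jumps δ) (jumps δ')
    θ-jumps = ImgEq-intro λ x y →
      ⇔.trans (Jumps.Jump-jumps⇔ δ≤M δ≡1)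
              (⇔.trans (θ-JumpClass x y) (⇔.sym (Jumps.Jump-jumps⇔ δ'≤M δ'≡1)))

  -- The edge 0 — δ is mapped to the edge 0 — θ δ = δ + 5t of C_N(U); its translate
  -- 4 — 4 + θ δ must then be the image of an edge x — y with x ≡ 4 and y ≡ 0 (mod 5),
  -- whose jump y - x ≡ δ + 25t (mod N) is ≡ 1 (mod 5) and hence ≡ δ (mod M).
  module _ {δ t : ℕ} {U : JumpSet} (δ≤M : δ ℕ.≤ M) (δ≡1 : + δ ≡ + 1 [mod + 5 ])
           (img : ImgEq N 5 t (jumps δ) U) where

    open Θ t

    private
      τ : ℕ → ℕ
      τ = θ N 5 t

      0<N : 0 < N
      0<N = s≤s z≤n

      4<N : 4 < N
      4<N = ℕ.≤-trans (ℕ.m≤m+n 5 120) (ℕ.m≤m*n 125 n)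

      δ<N : δ < N
      δ<N = ℕ.≤-<-trans δ≤M (ℕ.*-monoˡ-< n {25} {125} (ℕ.m≤m+n 26 99))

      b : ℕ
      b = (4 ℕ.+ τ δ) % N

      b-4≡τδ : + b - + 4 ≡ + τ δ [mod + N ]
      b-4≡τδ = mod-shift {b = + 4} (mod-trans (%-mod (4 ℕ.+ τ δ) N) (mod-reflexive (ℤ.pos-+ 4 (τ δ))))

      τδ≡δ+F : + τ δ ≡ + δ + F [mod + N ]
      τδ≡δ+F = mod-trans (θ-≡ δ)
        (mod-reflexive (trans (cong (λ r → + δ + + r * F) δ%5≡1) (cong (_+_ (+ δ)) (ℤ.*-identityˡ F))))
        where
        δ%5≡1 : δ % 5 ≡ 1
        δ%5≡1 = mod-unique (ℕ.m%n<n δ 5) (s≤s (s≤s z≤n)) (mod-trans (%-mod δ 5) δ≡1)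

      b≡0 : + b ≡ + 0 [mod + 5 ]
      b≡0 = begin
        + b                 ≈⟨ mod-weaken 5∣N (mod-unshift {b = + 4} b-4≡τδ) ⟩
        + 4 + + τ δ         ≈⟨ +-cong-mod (mod-refl {a = + 4}) (mod-weaken 5∣N τδ≡δ+F) ⟩
        + 4 + (+ δ + F)     ≈⟨ +-cong-mod (mod-refl {a = + 4}) δ+F≡1 ⟩
        + 5                 ≈⟨ modulus≡0-mod ⟩
        + 0                 ∎
        where
        open ModReasoning (+ 5)
        δ+F≡1 : + δ + F ≡ + 1 [mod + 5 ]
        δ+F≡1 = mod-trans (+-absorbʳ-mod (multipleˡ≡0-mod (+ t))) δ≡1

      translated-edge : Adj N U 4 b
      translated-edge = Jump⇒Adj 4<N (ℕ.m%n<n (4 ℕ.+ τ δ) N)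
        (Jump-cong (mod-trans (mod-reflexive (ℤ.+-identityʳ (+ τ δ))) (mod-sym b-4≡τδ))
                   (Adj⇒Jump image-edge))
        where
        base-edge : Adj N (jumps δ) 0 δ
        base-edge = Jump⇒Adj 0<N δ<N (δ , there (here refl) , inj₁ (mod-reflexive (ℤ.+-identityʳ (+ δ))))
        image-edge : Adj N U 0 (τ δ)
        image-edge = Equivalence.to (img 0 (τ δ) 0<N (θ<N δ)) (0 , δ , 0<N , δ<N , base-edge , refl , refl)

      preimage-jump : ∀ x y → τ x ≡ 4 → τ y ≡ b → + y - + x ≡ + δ + + 5 * F [mod + N ]
      preimage-jump x y τx≡4 τy≡b = +-cancelʳ-mod ((+ 0 - + 4) * F) (begin
        (+ y - + x) + (+ 0 - + 4) * F          ≈⟨ θ-diff-residues x y x%5≡4 y%5≡0 ⟨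
        + τ y - + τ x                          ≡⟨ cong₂ (λ p q → + p - + q) τy≡b τx≡4 ⟩
        + b - + 4                              ≈⟨ mod-trans b-4≡τδ τδ≡δ+F ⟩
        + δ + F                                ≡⟨ regroup (+ δ) F ⟩
        (+ δ + + 5 * F) + (+ 0 - + 4) * F      ∎)
        where
        open ModReasoning (+ N)
        regroup : ∀ a f → a + f ≡ (a + + 5 * f) + (+ 0 - + 4) * f
        regroup a f = solve (a ∷ f ∷ [])
        x%5≡4 : x % 5 ≡ 4
        x%5≡4 = mod-unique (ℕ.m%n<n x 5) (ℕ.n<1+n 4)
          (mod-trans (%-mod x 5) (mod-trans (mod-sym (θ-≡-mod-m x)) (mod-reflexive (cong +_ τx≡4))))
        y%5≡0 : y % 5 ≡ 0
        y%5≡0 = mod-unique (ℕ.m%n<n y 5) (s≤s z≤n)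
          (mod-trans (%-mod y 5) (mod-trans (mod-sym (θ-≡-mod-m y))
                                            (mod-trans (mod-reflexive (cong +_ τy≡b)) b≡0)))

      preimage⇒n∣t : ImgAdj N 5 t (jumps δ) 4 b → n ℕ.∣ t
      preimage⇒n∣t (x , y , _ , _ , x~y , τx≡4 , τy≡b) = ≡0-mod⇒∣ t≡0
        where
        y-x≡δ+5F : + y - + x ≡ + δ + + 5 * F [mod + N ]
        y-x≡δ+5F = preimage-jump x y τx≡4 τy≡b
        y-x≡δ : + y - + x ≡ + δ [mod + M ]
        y-x≡δ = JumpClass-≡1 δ≡1 (Equivalence.to (Jumps.Jump-jumps⇔ δ≤M δ≡1) (Adj⇒Jump x~y))
          (mod-trans (mod-weaken 5∣N y-x≡δ+5F) (mod-trans (+-absorbʳ-mod (multipleˡ≡0-mod F)) δ≡1))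
        5F≡0 : + 5 * F ≡ + 0 [mod + M ]
        5F≡0 = +-cancelˡ-mod (+ δ) (mod-trans (mod-sym (mod-weaken M∣N y-x≡δ+5F))
          (mod-trans y-x≡δ (mod-reflexive (sym (ℤ.+-identityʳ (+ δ))))))
        regroup : ∀ a → a * + 25 ≡ + 5 * (+ 5 * a)
        regroup a = solve (a ∷ [])
        t≡0 : + t ≡ + 0 [mod + n ]
        t≡0 = *-cancel-mod (+ 25) (mod-resp-modulus (trans (ℤ.pos-* 25 n) (ℤ.*-comm (+ 25) (+ n)))
          (mod-trans (mod-reflexive (regroup (+ t))) 5F≡0))

    θ-jumps⇒n∣t : n ℕ.∣ t
    θ-jumps⇒n∣t =
      preimage⇒n∣t (Equivalence.from (img 4 b 4<N (ℕ.m%n<n (4 ℕ.+ τ δ) N)) translated-edge)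

  -- R⟨ z ⟩ is the paper's R_i with i = (z mod 5) + 1; indexing by ℤ lets θ_{N,5,nk} act as
  -- z ↦ z + k.
  δ⟨_⟩ : ℤ → ℕ
  δ⟨ z ⟩ = d n (suc (z %ℕ 5))

  R⟨_⟩ : ℤ → JumpSet
  R⟨ z ⟩ = Rset n (suc (z %ℕ 5))

  δ⟨⟩≤M : ∀ z → δ⟨ z ⟩ ℕ.≤ M
  δ⟨⟩≤M z = ℕ.≤-trans
    (ℕ.+-mono-≤ (ℕ.*-monoʳ-≤ (5 ℕ.* n) (ℕ.s≤s⁻¹ (n%ℕd<d z 5))) (s≤s z≤n))
    (ℕ.≤-reflexive (regroup n))
    where
    regroup : ∀ a → 5 ℕ.* a ℕ.* 4 ℕ.+ 5 ℕ.* a ≡ 25 ℕ.* a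
    regroup a = ℕ-Solver.solve (a ∷ [])

  private
    M≡5*5n : + M ≡ + 5 * (+ 5 * + n)
    M≡5*5n = trans (ℤ.pos-* 25 n) (ℤ.*-assoc (+ 5) (+ 5) (+ n))

  δ⟨⟩≡ : ∀ z → + δ⟨ z ⟩ ≡ z * (+ 5 * + n) + + 1 [mod + M ]
  δ⟨⟩≡ z = begin
    + δ⟨ z ⟩                  ≡⟨ ℤ.pos-+ (5 ℕ.* n ℕ.* r) 1 ⟩
    + (5 ℕ.* n ℕ.* r) + + 1   ≡⟨ cong (_+ + 1) (trans (ℤ.pos-* (5 ℕ.* n) r) (cong (_* + r) (ℤ.pos-* 5 n))) ⟩
    (+ 5 * + n) * + r + + 1   ≡⟨ cong (_+ + 1) (ℤ.*-comm (+ 5 * + n) (+ r)) ⟩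
    + r * (+ 5 * + n) + + 1   ≈⟨ +-cong-mod r*5n≡z*5n mod-refl ⟩
    z * (+ 5 * + n) + + 1     ∎
    where
    open ModReasoning (+ M)
    r : ℕ
    r = z %ℕ 5
    r*5n≡z*5n : + r * (+ 5 * + n) ≡ z * (+ 5 * + n) [mod + M ]
    r*5n≡z*5n = mod-resp-modulus (sym M≡5*5n) (*-scale-mod (+ 5 * + n) (%ℕ-mod z 5))

  δ⟨⟩≡1 : ∀ z → + δ⟨ z ⟩ ≡ + 1 [mod + 5 ]
  δ⟨⟩≡1 z = mod-trans (mod-weaken 5∣M (δ⟨⟩≡ z)) (+-absorbˡ-mod (*-multiple≡0-mod z (+ n)))

  δ⟨⟩-shift : ∀ z k → + δ⟨ z + + k ⟩ ≡ + δ⟨ z ⟩ + + 5 * + (n ℕ.* k) [mod + M ]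
  δ⟨⟩-shift z k = begin
    + δ⟨ z + + k ⟩                                 ≈⟨ δ⟨⟩≡ (z + + k) ⟩
    (z + + k) * (+ 5 * + n) + + 1                  ≡⟨ regroup z (+ k) (+ n) ⟩
    (z * (+ 5 * + n) + + 1) + + 5 * (+ n * + k)    ≈⟨ +-cong-mod (mod-sym (δ⟨⟩≡ z)) (mod-reflexive nk≡n*k) ⟩
    + δ⟨ z ⟩ + + 5 * + (n ℕ.* k)                   ∎
    where
    open ModReasoning (+ M)
    regroup : ∀ z k a → (z + k) * (+ 5 * a) + + 1 ≡ (z * (+ 5 * a) + + 1) + + 5 * (a * k)
    regroup z k a = solve (z ∷ k ∷ a ∷ [])
    nk≡n*k : + 5 * (+ n * + k) ≡ + 5 * + (n ℕ.* k)
    nk≡n*k = cong (+ 5 *_) (sym (ℤ.pos-* n k))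

  δ⟨⟩-injective : ∀ {z w} → + δ⟨ z ⟩ ≡± + δ⟨ w ⟩ [mod + M ] → z ≡ w [mod + 5 ]
  δ⟨⟩-injective {z} {w} (inj₁ δz≡δw) = *-cancel-mod (+ 5 * + n) (mod-resp-modulus M≡5*5n
    (+-cancelʳ-mod (+ 1) (mod-trans (mod-sym (δ⟨⟩≡ z)) (mod-trans δz≡δw (δ⟨⟩≡ w)))))
  δ⟨⟩-injective {z} {w} (inj₂ δz≡-δw) =
    ⊥-elim (1≢-1-mod5 (δ⟨⟩≡1 z) (mod-trans (mod-weaken 5∣M δz≡-δw) (neg-cong-mod (δ⟨⟩≡1 w))))

  Jump-R⟨⟩⇔ : ∀ {z u} → Jump R⟨ z ⟩ u ⇔ JumpClass δ⟨ z ⟩ u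
  Jump-R⟨⟩⇔ {z} = Jumps.Jump-jumps⇔ (δ⟨⟩≤M z) (δ⟨⟩≡1 z)

  Jump-R⟨⟩-index : ∀ {z w u} → Jump R⟨ z ⟩ u → u ≡± + δ⟨ w ⟩ [mod + M ] → z ≡ w [mod + 5 ]
  Jump-R⟨⟩-index {z} {w} {u} u∈Rz u≡±δw = δ⟨⟩-injective (±-trans (±-sym u≡±δz) u≡±δw)
    where
    u≡±δz : u ≡± + δ⟨ z ⟩ [mod + M ]
    u≡±δz = JumpClass-≡±1 (δ⟨⟩≡1 z) (Equivalence.to (Jump-R⟨⟩⇔ {z}) u∈Rz)
                          (≡±δ⇒≡±1 (δ⟨⟩≡1 w) u≡±δw)

  R⟨⟩-cong : ∀ {z w} → z ≡ w [mod + 5 ] → R⟨ z ⟩ ≡ R⟨ w ⟩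
  R⟨⟩-cong z≡w = cong (λ r → Rset n (suc r)) (%ℕ-cong 5 z≡w)

  R⟨⟩-injective : ∀ {z w} → SetEq N R⟨ z ⟩ R⟨ w ⟩ → z ≡ w [mod + 5 ]
  R⟨⟩-injective {z} {w} Rz≅Rw =
    Jump-R⟨⟩-index {z} {w}
      (SetEq⇒Jump {R⟨ w ⟩} {R⟨ z ⟩} (SetEq-sym {R⟨ z ⟩} {R⟨ w ⟩} Rz≅Rw) δw∈Rw) (inj₁ mod-refl)
    where
    δw∈Rw : Jump R⟨ w ⟩ (+ δ⟨ w ⟩)
    δw∈Rw = δ⟨ w ⟩ , there (here refl) , inj₁ mod-refl

  R⟨⟩-scaled : ∀ {z w} x → SetEq N R⟨ w ⟩ (scale x R⟨ z ⟩) → w ≡ z [mod + 5 ]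
  R⟨⟩-scaled {z} {w} x Rw≅xRz = Jump-R⟨⟩-index {w} {z} (scaled-jump (there (here refl))) xδ≡±δ
    where
    scaled-jump : ∀ {s} → s ∈ R⟨ z ⟩ → Jump R⟨ w ⟩ (+ (x ℕ.* s))
    scaled-jump {s} s∈Rz =
      SetEq⇒Jump {scale x R⟨ z ⟩} {R⟨ w ⟩} (SetEq-sym {R⟨ w ⟩} {scale x R⟨ z ⟩} Rw≅xRz)
      (x ℕ.* s , ∈-map⁺ (x ℕ.*_) s∈Rz , inj₁ mod-refl)
    x*5≡±5 : + (x ℕ.* 5) ≡± + 5 [mod + N ]
    x*5≡±5 = JumpClass-≡0 (δ⟨⟩≡1 w) (Equivalence.to (Jump-R⟨⟩⇔ {w}) (scaled-jump (here refl)))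
      (mod-trans (mod-reflexive (ℤ.pos-* x 5)) (multiple≡0-mod (+ x)))
    x≡±1 : + x ≡± + 1 [mod + M ]
    x≡±1 = ±-*-cancel-mod (+ 5) (subst (λ v → + x * + 5 ≡± + 5 [mod v ])
      (trans N≡5*M (ℤ.*-comm (+ 5) (+ M))) (±-trans (inj₁ (mod-reflexive (sym (ℤ.pos-* x 5)))) x*5≡±5))
    xδ≡±δ : + (x ℕ.* δ⟨ z ⟩) ≡± + δ⟨ z ⟩ [mod + M ]
    xδ≡±δ = ±-trans (inj₁ (mod-reflexive (trans (ℤ.pos-* x δ⟨ z ⟩) (ℤ.*-comm (+ x) (+ δ⟨ z ⟩)))))
      (±-trans (±-*-congˡ (+ δ⟨ z ⟩) x≡±1) (inj₁ (mod-reflexive (ℤ.*-identityʳ (+ δ⟨ z ⟩)))))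

  θ-R⟨⟩ : ∀ z k → ImgEq N 5 (n ℕ.* k) R⟨ z ⟩ R⟨ z + + k ⟩
  θ-R⟨⟩ z k = θ-jumps {k = k} (δ⟨⟩≤M z) (δ⟨⟩≤M (z + + k)) (δ⟨⟩≡1 z) (δ⟨⟩-shift z k)

  θ-R⟨⟩-only : ∀ {z t U} → ImgEq N 5 t R⟨ z ⟩ U →
               ∃[ k ] (t ≡ n ℕ.* k × SetEq N U R⟨ z + + k ⟩)
  θ-R⟨⟩-only {z} {t} {U} img = multiple (θ-jumps⇒n∣t (δ⟨⟩≤M z) (δ⟨⟩≡1 z) img)
    where
    multiple : n ℕ.∣ t → ∃[ k ] (t ≡ n ℕ.* k × SetEq N U R⟨ z + + k ⟩)
    multiple (ℕ.divides k t≡k*n) = k , t≡n*k ,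
      ImgEq⇒SetEq {5} {n ℕ.* k} {R⟨ z ⟩} (subst (λ v → ImgEq N 5 v R⟨ z ⟩ U) t≡n*k img) (θ-R⟨⟩ z k)
      where
      t≡n*k : t ≡ n ℕ.* k
      t≡n*k = trans t≡k*n (ℕ.*-comm k n)

  card-R⟨⟩ : ∀ z → card N R⟨ z ⟩ ≡ 6
  card-R⟨⟩ z = Jumps.card-jumps (δ⟨⟩≤M z) (δ⟨⟩≡1 z)

  N/5≡M : N div 5 ≡ M
  N/5≡M = trans (cong (_/ 5) (trans (ℕ.*-assoc 5 25 n) (ℕ.*-comm 5 M))) (ℕ.m*n/n≡m M 5)

  R⟨⟩-Type2Iso : ∀ {z w U} → ¬ z ≡ w [mod + 5 ] → SetEq N U R⟨ w ⟩ → Type2Iso N 5 R⟨ z ⟩ U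
  R⟨⟩-Type2Iso {z} {w} {U} z≢w U≅Rw =
      trans (card-R⟨⟩ z) (sym (trans (card-resp-SetEq {U} {R⟨ w ⟩} U≅Rw) (card-R⟨⟩ w)))
    , subst (3 ℕ.≤_) (sym (card-R⟨⟩ z)) (s≤s (s≤s (s≤s z≤n)))
    , (λ Rz≅U → z≢w (R⟨⟩-injective (SetEq-trans {R⟨ z ⟩} {U} {R⟨ w ⟩} Rz≅U U≅Rw)))
    , s≤s (s≤s z≤n)
    , (5 , here refl , gcd-greatest 5∣ℕN ℕ.∣-refl)
    , ℕ.m∣m*n n
    , (n ℕ.* k , ℕ.*-mono-≤ {1} {n} {1} {k} (s≤s z≤n) 1≤k , nk≤N/5-1 , θ-Rz↦U)
    , (λ x _ U≅xRz → z≢w (mod-sym (R⟨⟩-scaled {z} {w} x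
        (SetEq-trans {R⟨ w ⟩} {U} {scale x R⟨ z ⟩} (SetEq-sym {U} {R⟨ w ⟩} U≅Rw) U≅xRz))))
    where
    k : ℕ
    k = (w - z) %ℕ 5
    1≤k : 1 ℕ.≤ k
    1≤k = ℕ.n≢0⇒n>0 λ k≡0 → z≢w (mod-sym (mod-diff≡0 {a = w} {z}
      (mod-trans (mod-sym (%ℕ-mod (w - z) 5)) (mod-reflexive (cong +_ k≡0)))))
    nk≤N/5-1 : n ℕ.* k ℕ.≤ N div 5 ∸ 1
    nk≤N/5-1 = subst (λ v → n ℕ.* k ℕ.≤ v ∸ 1) (sym N/5≡M) (ℕ.<⇒≤pred
      (subst (n ℕ.* k <_) (ℕ.*-comm n 25) (ℕ.*-monoʳ-< n (ℕ.<-≤-trans (n%ℕd<d (w - z) 5) (ℕ.m≤m+n 5 20)))))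
    z+k≡w : z + + k ≡ w [mod + 5 ]
    z+k≡w = mod-trans (+-cong-mod (mod-refl {a = z}) (%ℕ-mod (w - z) 5))
                      (mod-reflexive (solve (z ∷ w ∷ [])))
    θ-Rz↦U : ImgEq N 5 (n ℕ.* k) R⟨ z ⟩ U
    θ-Rz↦U = ImgEq-resp-SetEq {5} {n ℕ.* k} {R⟨ z ⟩} {R⟨ w ⟩} {U} (SetEq-sym {U} {R⟨ w ⟩} U≅Rw)
      (subst (ImgEq N 5 (n ℕ.* k) R⟨ z ⟩) (R⟨⟩-cong z+k≡w) (θ-R⟨⟩ z k))

  InT2-R⟨⟩⇔ : ∀ {z S} → InT2 N 5 R⟨ z ⟩ S ⇔ (∃[ w ] SetEq N S R⟨ w ⟩)
  InT2-R⟨⟩⇔ {z} {S} = mk⇔ to from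
    where
    to : InT2 N 5 R⟨ z ⟩ S → ∃[ w ] SetEq N S R⟨ w ⟩
    to (inj₁ S≅Rz) = z , S≅Rz
    to (inj₂ (_ , _ , _ , _ , _ , _ , (_ , _ , _ , θ-Rz↦S) , _)) =
      let (k , _ , S≅Rz+k) = θ-R⟨⟩-only {z} θ-Rz↦S in z + + k , S≅Rz+k
    from : ∃[ w ] SetEq N S R⟨ w ⟩ → InT2 N 5 R⟨ z ⟩ S
    from (w , S≅Rw) = decide (mod-dec z w)
      where
      decide : Dec (z ≡ w [mod + 5 ]) → InT2 N 5 R⟨ z ⟩ S
      decide (yes z≡w) = inj₁ (subst (SetEq N S) (sym (R⟨⟩-cong z≡w)) S≅Rw)
      decide (no z≢w) = inj₂ (R⟨⟩-Type2Iso z≢w S≅Rw)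

  -- The offset ⟦ a ⟧ ≡ w - ι of a ≅ R⟨ w ⟩ from the base point R⟨ ι ⟩ is a group
  -- monomorphism into ℤ/5ℤ, along which the group laws are pulled back.
  module Type2GroupOf (ι : ℤ) where

    G : Set
    G = T2Carrier N 5 R⟨ ι ⟩

    index : G → ℤ
    index (S , S∈T2) = proj₁ (Equivalence.to (InT2-R⟨⟩⇔ {ι} {S}) S∈T2)

    index-spec : ∀ a → SetEq N (proj₁ a) R⟨ index a ⟩
    index-spec (S , S∈T2) = proj₂ (Equivalence.to (InT2-R⟨⟩⇔ {ι} {S}) S∈T2)

    element : ℤ → G
    element w = R⟨ w ⟩ , Equivalence.from (InT2-R⟨⟩⇔ {ι} {R⟨ w ⟩}) (w , SetEq-refl {R⟨ w ⟩})

    ⟦_⟧ : G → ℤ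
    ⟦ a ⟧ = index a - ι

    ⟦⟧-spec : ∀ a {w} → SetEq N (proj₁ a) R⟨ w ⟩ → ⟦ a ⟧ ≡ w - ι [mod + 5 ]
    ⟦⟧-spec a {w} a≅Rw = +-cong-mod (R⟨⟩-injective {index a} {w} Ra≅Rw) (mod-refl {a = - ι})
      where
      Ra≅Rw : SetEq N R⟨ index a ⟩ R⟨ w ⟩
      Ra≅Rw = SetEq-trans {R⟨ index a ⟩} {proj₁ a} {R⟨ w ⟩}
                (SetEq-sym {proj₁ a} {R⟨ index a ⟩} (index-spec a)) a≅Rw

    ⟦element⟧ : ∀ w → ⟦ element w ⟧ ≡ w - ι [mod + 5 ]
    ⟦element⟧ w = ⟦⟧-spec (element w) {w} (SetEq-refl {R⟨ w ⟩})

    _∙_ : G → G → G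
    a ∙ b = element (ι + (⟦ a ⟧ + ⟦ b ⟧))

    ε : G
    ε = element ι

    _⁻¹ : G → G
    a ⁻¹ = element (ι - ⟦ a ⟧)

    private
      cancel : ∀ i x → (i + x) - i ≡ x
      cancel i x = solve (i ∷ x ∷ [])

    rawGroup : RawGroup _ _
    rawGroup = record { Carrier = G ; _≈_ = GraphEq N 5 R⟨ ι ⟩ ; _∙_ = _∙_ ; ε = ε ; _⁻¹ = _⁻¹ }

    ℤ/5-rawGroup : RawGroup _ _
    ℤ/5-rawGroup = record { Carrier = ℤ ; _≈_ = _≡_[mod + 5 ] ; _∙_ = _+_ ; ε = + 0 ; _⁻¹ = -_ }

    ⟦⟧-isGroupMonomorphism : IsGroupMonomorphism rawGroup ℤ/5-rawGroup ⟦_⟧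
    ⟦⟧-isGroupMonomorphism = record
      { isGroupHomomorphism = record
        { isMonoidHomomorphism = record
          { isMagmaHomomorphism = record
            { isRelHomomorphism = record { cong = λ {a} {b} a≅b →
                ⟦⟧-spec a {index b} (SetEq-trans {proj₁ a} {proj₁ b} {R⟨ index b ⟩} a≅b (index-spec b)) }
            ; homo = λ a b → mod-trans (⟦element⟧ (ι + (⟦ a ⟧ + ⟦ b ⟧)))
                                       (mod-reflexive (cancel ι (⟦ a ⟧ + ⟦ b ⟧)))
            }
          ; ε-homo = mod-trans (⟦element⟧ ι) (mod-reflexive (ℤ.+-inverseʳ ι))
          }
        ; ⁻¹-homo = λ a → mod-trans (⟦element⟧ (ι - ⟦ a ⟧)) (mod-reflexive (cancel ι (- ⟦ a ⟧)))
        }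
      ; injective = λ {a} {b} ⟦a⟧≡⟦b⟧ → SetEq-trans {proj₁ a} {R⟨ index a ⟩} {proj₁ b} (index-spec a)
          (subst (λ S → SetEq N S (proj₁ b))
            (R⟨⟩-cong {index b} {index a} (mod-sym (+-cancelʳ-mod (- ι) {index a} {index b} ⟦a⟧≡⟦b⟧)))
            (SetEq-sym {proj₁ b} {R⟨ index b ⟩} (index-spec b)))
      }

    isGroup : IsGroup (GraphEq N 5 R⟨ ι ⟩) _∙_ ε _⁻¹
    isGroup = GroupMonomorphism.isGroup ⟦⟧-isGroupMonomorphism (+-0-isGroup-mod (+ 5))

    image-offset : ∀ a {t} → ImgEq N 5 t R⟨ ι ⟩ (proj₁ a) →
                   ∃[ k ] (t ≡ n ℕ.* k × (+ k ≡ ⟦ a ⟧ [mod + 5 ]))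
    image-offset a {t} θ-Rι↦a = let (k , t≡nk , a≅Rk) = θ-R⟨⟩-only {ι} θ-Rι↦a in
      k , t≡nk , mod-trans (mod-reflexive (sym (cancel ι (+ k)))) (mod-sym (⟦⟧-spec a {ι + + k} a≅Rk))

    Rep-∙ : ∀ a b t t' → Rep N 5 R⟨ ι ⟩ a t → Rep N 5 R⟨ ι ⟩ b t' →
            Rep N 5 R⟨ ι ⟩ (a ∙ b) ((t ℕ.+ t') mod (N div 5))
    Rep-∙ a b t t' (_ , θ-Rι↦a) (_ , θ-Rι↦b) =
      compose (image-offset a θ-Rι↦a) (image-offset b θ-Rι↦b)
      where
      compose : ∃[ k ] (t ≡ n ℕ.* k × (+ k ≡ ⟦ a ⟧ [mod + 5 ])) →
                ∃[ k' ] (t' ≡ n ℕ.* k' × (+ k' ≡ ⟦ b ⟧ [mod + 5 ])) →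
                Rep N 5 R⟨ ι ⟩ (a ∙ b) ((t ℕ.+ t') mod (N div 5))
      compose (k , refl , k≡⟦a⟧) (k' , refl , k'≡⟦b⟧) =
        subst (λ v → Rep N 5 R⟨ ι ⟩ (a ∙ b) (t″ mod v)) (sym N/5≡M)
              (subst (t″ % M <_) (sym N/5≡M) (ℕ.m%n<n t″ M) , θ-Rι↦ab)
        where
        t″ K : ℕ
        t″ = n ℕ.* k ℕ.+ n ℕ.* k'
        K = (k ℕ.+ k') % 25
        t″%M≡nK : t″ % M ≡ n ℕ.* K
        t″%M≡nK = begin
          t″ % M                 ≡⟨ cong (_% M) (trans (sym (ℕ.*-distribˡ-+ n k k')) (ℕ.*-comm n (k ℕ.+ k'))) ⟩
          (k ℕ.+ k') ℕ.* n % M   ≡⟨ ℕ.m%n*o≡m*o%[n*o] (k ℕ.+ k') 25 n ⟨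
          K ℕ.* n                ≡⟨ ℕ.*-comm K n ⟩
          n ℕ.* K                ∎
          where open ≡-Reasoning
        K≡⟦a⟧+⟦b⟧ : + K ≡ ⟦ a ⟧ + ⟦ b ⟧ [mod + 5 ]
        K≡⟦a⟧+⟦b⟧ = begin
          + K              ≈⟨ mod-weaken (divides (+ 5) refl) (%-mod (k ℕ.+ k') 25) ⟩
          + (k ℕ.+ k')     ≡⟨ ℤ.pos-+ k k' ⟩
          + k + + k'       ≈⟨ +-cong-mod k≡⟦a⟧ k'≡⟦b⟧ ⟩
          ⟦ a ⟧ + ⟦ b ⟧    ∎
          where open ModReasoning (+ 5)
        θ-Rι↦ab : ImgEq N 5 (t″ % M) R⟨ ι ⟩ (proj₁ (a ∙ b))
        θ-Rι↦ab = subst₂ (λ t₀ R → ImgEq N 5 t₀ R⟨ ι ⟩ R) (sym t″%M≡nK)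
          (R⟨⟩-cong {ι + + K} {ι + (⟦ a ⟧ + ⟦ b ⟧)} (+-cong-mod (mod-refl {a = ι}) K≡⟦a⟧+⟦b⟧))
          (θ-R⟨⟩ ι K)

  Type2Group-R⟨⟩ : ∀ ι → Type2Group N 5 R⟨ ι ⟩
  Type2Group-R⟨⟩ ι = _∙_ , ε , _⁻¹ , isGroup , Rep-∙
    where open Type2GroupOf ι

  Rset≡R⟨⟩ : ∀ {j} → j < 5 → Rset n (suc j) ≡ R⟨ + j ⟩
  Rset≡R⟨⟩ j<5 = cong (λ r → Rset n (suc r)) (sym (ℕ.m<n⇒m%n≡m j<5))

  Rset-Type2Iso : ∀ i j → 1 ℕ.≤ i → i ℕ.≤ 5 → 1 ℕ.≤ j → j ℕ.≤ 5 → i ≢ j →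
                  Type2Iso N 5 (Rset n i) (Rset n j)
  Rset-Type2Iso (suc i) (suc j) _ i<5 _ j<5 i≢j =
    subst (λ R → Type2Iso N 5 R (Rset n (suc j))) (sym (Rset≡R⟨⟩ i<5))
      (R⟨⟩-Type2Iso (i≢j ∘ cong suc ∘ mod-unique i<5 j<5)
                    (subst (SetEq N (Rset n (suc j))) (Rset≡R⟨⟩ j<5) (SetEq-refl {Rset n (suc j)})))

  InT2-Rset⇔ : ∀ i → 1 ℕ.≤ i → i ℕ.≤ 5 → (S : JumpSet) →
               InT2 N 5 (Rset n i) S ⇔ (∃[ j ] (1 ℕ.≤ j × j ℕ.≤ 5 × SetEq N S (Rset n j)))
  InT2-Rset⇔ (suc i) _ i<5 S =
    subst (λ R → InT2 N 5 R S ⇔ (∃[ j ] (1 ℕ.≤ j × j ℕ.≤ 5 × SetEq N S (Rset n j))))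
      (sym (Rset≡R⟨⟩ i<5)) (⇔.trans (InT2-R⟨⟩⇔ {+ i} {S}) (mk⇔ to from))
    where
    to : ∃[ w ] SetEq N S R⟨ w ⟩ → ∃[ j ] (1 ℕ.≤ j × j ℕ.≤ 5 × SetEq N S (Rset n j))
    to (w , S≅Rw) = suc (w %ℕ 5) , s≤s z≤n , n%ℕd<d w 5 , S≅Rw
    from : ∃[ j ] (1 ℕ.≤ j × j ℕ.≤ 5 × SetEq N S (Rset n j)) → ∃[ w ] SetEq N S R⟨ w ⟩
    from (suc j , _ , j<5 , S≅Rj) = + j , subst (SetEq N S) (Rset≡R⟨⟩ j<5) S≅Rj

  Rset-Type2Group : ∀ i → 1 ℕ.≤ i → i ℕ.≤ 5 → Type2Group N 5 (Rset n i)
  Rset-Type2Group (suc i) _ i<5 = subst (Type2Group N 5) (sym (Rset≡R⟨⟩ i<5)) (Type2Group-R⟨⟩ (+ i))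

open import Data.Nat using (ℕ; _*_; _≤_)
open import Data.Product using (_×_; ∃-syntax)
open import Function.Bundles using (_⇔_)
open import Relation.Binary.PropositionalEquality using (_≢_)

theorem5p10 : (n : ℕ) → 1 ≤ n →
    ((i j : ℕ) → 1 ≤ i → i ≤ 5 → 1 ≤ j → j ≤ 5 → i ≢ j →
       Type2Iso (125 * n) 5 (Rset n i) (Rset n j))
    × ((i : ℕ) → 1 ≤ i → i ≤ 5 → (S : JumpSet) →
       InT2 (125 * n) 5 (Rset n i) S ⇔ (∃[ j ] (1 ≤ j × j ≤ 5 × SetEq (125 * n) S (Rset n j))))
    × ((i : ℕ) → 1 ≤ i → i ≤ 5 → Type2Group (125 * n) 5 (Rset n i))
theorem5p10 zero ()
theorem5p10 (suc n') _ = Rset-Type2Iso , InT2-Rset⇔ , Rset-Type2Group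
  where open Family n'
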